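{- Let $n$ be a positive integer, written $n=p_1^{k_1}\cdots p_{\omega(n)}^{k_{\omega(n)}}$ with distinct primes $p_i$ and $k_i\in\mathbb{N}$, and let $f=\Phi_n$ be the $n$-th cyclotomic polynomial. Then for all indices $1\le i,j\le \varphi(n)$, \[ (M_f^\dagger M_f)_{ij}=\begin{cases} \varphi(n) & \text{if } i=j,\\ 0 & \text{if } \frac{n}{\operatorname{rad}(n)}\nmid i-j,\\ (-1)^{\omega(n)+\omega(d)}\left(\frac{n}{\operatorname{rad}(n)}\right)\varphi(\operatorname{rad}(d)) & \text{if } i\neq j \text{ and } \frac{n}{\operatorname{rad}(n)}\mid i-j, \end{cases} \] where $d=\gcd\!\left(\frac{i-j}{n/\operatorname{rad}(n)},\,n\right)$.
   Context: For a monic polynomial $f\in\mathbb{Z}[x]$ of degree $m$ with distinct complex roots $\alpha_1,\dots,\alpha_m$, $M_f$ denotes the $m\times m$ Vandermonde matrix with $(i,j)$ entry $\alpha_i^{\,j-1}$, and $M_f^\dagger$ its conjugate transpose. $\Phi_n$ is the $n$-th cyclotomic polynomial (degree $\varphi(n)$, $\varphi$ Euler's totient function). $\omega(m)$ is the number of distinct prime divisors of $m$, and $\operatorname{rad}(m)$ is the product of the distinct primes dividing $m$. -}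

module Defs where

open import Level using (Level; _⊔_)
open import Algebra.Bundles using (CommutativeRing)
open import Data.Nat using (ℕ; zero; suc; _/_; _<_; _≤_)
open import Data.Nat.GCD using (gcd)
open import Data.Nat.Divisibility using (_∣_; _∣?_)
open import Data.Nat.Primality using (Prime; prime?)
open import Data.Fin using (Fin)
open import Data.List using (List; []; _∷_; filter; length)
open import Data.Nat.ListAction using (product)
open import Data.List.Base using (upTo)
open import Data.Product using (_×_)
open import Data.Sum using (_⊎_)
open import Relation.Nullary using (¬_; Dec; yes; no)
open import Relation.Nullary.Decidable using (_×-dec_)
open import Relation.Binary.PropositionalEquality using (_≡_)
open import Data.Nat using (_≟_)

oneTo : ℕ → List ℕ
oneTo n = Data.List.map suc (upTo n)

primeDivisors : ℕ → List ℕ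
primeDivisors n = filter (λ p → prime? p ×-dec (p ∣? n)) (oneTo n)

ω : ℕ → ℕ
ω n = length (primeDivisors n)

rad : ℕ → ℕ
rad n = product (primeDivisors n)

-- n / rad(n)  (rad n is never 0; the zero branch is unreachable)
nOverRad : ℕ → ℕ
nOverRad n with rad n
... | zero  = 0
... | suc k = n / suc k

φ : ℕ → ℕ
φ n = length (filter (λ a → gcd a n ≟ 1) (oneTo n))

module _ {c ℓ : Level} (R : CommutativeRing c ℓ) where
  open CommutativeRing R

  pow : Carrier → ℕ → Carrier
  pow x zero    = 1#
  pow x (suc k) = x * pow x k

  fromℕ : ℕ → Carrier
  fromℕ zero    = 0#
  fromℕ (suc k) = 1# + fromℕ k

  negPow : ℕ → Carrier → Carrier
  negPow zero    x = x
  negPow (suc k) x = - negPow k x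

  sumFin : (m : ℕ) → (Fin m → Carrier) → Carrier
  sumFin zero    g = 0#
  sumFin (suc m) g = g Fin.zero + sumFin m (λ k → g (Fin.suc k))
    where import Data.Fin as Fin

  IsIntegralDomain : Set (c ⊔ ℓ)
  IsIntegralDomain =
    (¬ (1# ≈ 0#)) × (∀ x y → x * y ≈ 0# → (x ≈ 0#) ⊎ (y ≈ 0#))

  CharZero : Set ℓ
  CharZero = ∀ k → ¬ (fromℕ (suc k) ≈ 0#)

  -- α is a primitive n-th root of unity, i.e. a root of Φ_n
  IsPrimitiveRoot : ℕ → Carrier → Set ℓ
  IsPrimitiveRoot n α =
    (pow α n ≈ 1#) × (∀ d → 1 ≤ d → d < n → ¬ (pow α d ≈ 1#))

  -- conj is an involutive ring endomorphism (abstract complex conjugation)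
  record IsConjugation (conj : Carrier → Carrier) : Set (c ⊔ ℓ) where
    field
      cong-conj : ∀ {x y} → x ≈ y → conj x ≈ conj y
      conj-+    : ∀ x y → conj (x + y) ≈ conj x + conj y
      conj-*    : ∀ x y → conj (x * y) ≈ conj x * conj y
      conj-1    : conj 1# ≈ 1#
      conj-invol : ∀ x → conj (conj x) ≈ x

  -- (M_f^† M_f)_{ij} for M_f the Vandermonde matrix of the roots α (0-based i, j)
  gramEntry : (conj : Carrier → Carrier) (m : ℕ) (α : Fin m → Carrier) →
              Fin m → Fin m → Carrier
  gramEntry conj m α i j =
    sumFin m (λ k → conj (pow (α k) (Data.Fin.toℕ i)) * pow (α k) (Data.Fin.toℕ j))
    where import Data.Fin

{-# OPTIONS --safe #-}
module Submission where

-- With ζ = α i, every α k is a power ζ^a with gcd(a, n) = 1, and conj inverts roots of unity, so the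
-- (i, j) entry is the Ramanujan sum c_n(d) = Σ_{a ≤ n, gcd(a, n) = 1} ζ^(a·d) with d = |i - j|, or its
-- conjugate.  The residues coprime to n are obtained from 1, …, n by sieving out the prime divisors of n
-- one at a time: the integers up to p·M prime to ∏L are those prime to p·∏L together with p times the
-- integers up to M prime to ∏L, which turns a sum of β^x into a difference involving (β^p)^x.  By
-- induction over the primes, if β has exact order t then the sum of β^x over the integers up to K·∏L
-- prime to ∏L is (-1)^#{p ∈ L : p ∣ t} · K · ∏_{p ∈ L, p ∤ t} (p - 1) when t ∣ ∏L, and 0 otherwise.
-- For β = ζ^d the order is n / gcd(n, d); it divides rad n exactly when n / rad n divides d, and then it
-- is the product of the primes of n that do not divide d / (n / rad n).

open import Defs
open import Algebra.Bundles using (CommutativeRing)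
open import Data.Nat using (ℕ; _≤_; ∣_-_∣)
import Data.Nat as N
open import Data.Nat.GCD using (gcd)
open import Data.Nat.Divisibility using (_∣_)
open import Data.Fin using (Fin; toℕ)
open import Data.Product using (_×_; _,_; proj₁; proj₂)
open import Function.Definitions using (Injective)
open import Relation.Nullary using (¬_)
open import Relation.Binary.PropositionalEquality using (_≡_)

module NumberTheory where
  open import Data.Nat
  open import Data.Nat.Properties
  open import Data.Nat.Divisibility
  open import Data.Nat.DivMod using (m/n*n≡m)
  open import Data.Nat.GCD using (gcd; gcd[m,n]∣m; gcd[m,n]∣n; gcd-greatest; gcd[m,n]≢0)
  open import Data.Nat.Coprimality using (Coprime; coprime-divisor; coprime-/gcd)
  open import Data.Nat.Primality
  open import Data.Nat.Primality.Factorisation using (factorise; factorisationHasAllPrimeFactors)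
  open import Data.Nat.ListAction using (product)
  open import Data.Nat.ListAction.Properties using (∈⇒∣product; product-↭)
  open import Data.Nat.Tactic.RingSolver using (solve-∀)
  open import Data.List using (List; []; _∷_; _++_; map; filter; length; upTo)
  open import Data.List.Properties using (length-++; length-map; length-applyUpTo; filter-≐; filter-all)
  open import Data.List.Membership.Propositional using (_∈_)
  open import Data.List.Membership.Propositional.Properties
  open import Data.List.Membership.Propositional.Properties.WithK using (unique∧set⇒bag)
  open import Data.List.Relation.Binary.BagAndSetEquality using (∼bag⇒↭)
  open import Data.List.Relation.Binary.Subset.Propositional using (_⊆_)
  open import Data.List.Relation.Unary.Any using (here; there)
  open import Data.List.Relation.Unary.All as All using (All; []; _∷_)
  open import Data.List.Relation.Unary.All.Properties using () renaming (filter⁺ to All-filter⁺)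
  open import Data.List.Relation.Unary.Unique.Propositional using (Unique; []; _∷_)
  import Data.List.Relation.Unary.Unique.Propositional.Properties as Unique
  open import Data.List.Relation.Binary.Permutation.Propositional using (_↭_; ↭-refl; ↭-prep; ↭-trans; ↭-sym)
  open import Data.List.Relation.Binary.Permutation.Propositional.Properties using (shift; ∈-resp-↭; ↭-length; map⁺)
  open import Data.Product using (_×_; _,_; proj₁; proj₂; ∃)
  open import Data.Sum using (_⊎_; inj₁; inj₂; fromInj₂)
  open import Data.Fin using (Fin; zero; suc)
  open import Function using (_∘_; _⇔_; mk⇔; Equivalence)
  import Function.Properties.Equivalence as ⇔
  open import Function.Related.TypeIsomorphisms using (¬-cong-⇔)
  open import Relation.Nullary.Decidable using (decidable-stable)
  open import Relation.Nullary using (¬_; yes; no; ¬?; contradiction; _×-dec_)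
  open import Relation.Unary using (Pred; Decidable)
  open import Relation.Binary.PropositionalEquality

  open Equivalence using (to; from)

  module _ {a} {A : Set a} where

    ⊆∧length≤⇒↭ : ∀ {xs ys : List A} → Unique xs → xs ⊆ ys → length ys ≤ length xs → xs ↭ ys
    ⊆∧length≤⇒↭ {[]}     {[]}    _ _ _ = ↭-refl
    ⊆∧length≤⇒↭ {[]}     {_ ∷ _} _ _ ()
    ⊆∧length≤⇒↭ {x ∷ xs} (x∉xs ∷ xs!) xs⊆ys len with ∈-∃++ (xs⊆ys (here refl))
    ... | us , vs , refl = ↭-trans (↭-prep x (⊆∧length≤⇒↭ xs! xs⊆us++vs len′)) (↭-sym (shift x us vs))
      where
      xs⊆us++vs : xs ⊆ us ++ vs
      xs⊆us++vs z∈xs with ∈-resp-↭ (shift x us vs) (xs⊆ys (there z∈xs))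
      ... | here refl       = contradiction refl (All.lookup x∉xs z∈xs)
      ... | there z∈us++vs = z∈us++vs
      len′ : length (us ++ vs) ≤ length xs
      len′ = ≤-pred (subst (_≤ suc (length xs)) (↭-length (shift x us vs)) len)

    unique-⇔⇒↭ : ∀ {xs ys : List A} → Unique xs → Unique ys → (∀ {x} → x ∈ xs ⇔ x ∈ ys) → xs ↭ ys
    unique-⇔⇒↭ xs! ys! xs⇔ys = ∼bag⇒↭ (unique∧set⇒bag xs! ys! xs⇔ys)

    filter-cong : ∀ {p q} {P : Pred A p} {Q : Pred A q} (P? : Decidable P) (Q? : Decidable Q) {xs} →
                  All (λ x → P x ⇔ Q x) xs → filter P? xs ≡ filter Q? xs
    filter-cong P? Q? [] = refl
    filter-cong P? Q? {x ∷ _} (P⇔Q ∷ rest) with P? x | Q? x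
    ... | yes _   | yes _   = cong (x ∷_) (filter-cong P? Q? rest)
    ... | no _    | no _    = filter-cong P? Q? rest
    ... | yes Px  | no ¬Qx  = contradiction (to P⇔Q Px) ¬Qx
    ... | no ¬Px  | yes Qx  = contradiction (from P⇔Q Qx) ¬Px

    length-filter-split : ∀ {p} {P : Pred A p} (P? : Decidable P) xs →
                          length xs ≡ length (filter (¬? ∘ P?) xs) + length (filter P? xs)
    length-filter-split P? [] = refl
    length-filter-split P? (x ∷ xs) with P? x
    ... | yes _ = trans (cong suc (length-filter-split P? xs)) (sym (+-suc _ _))
    ... | no _  = cong suc (length-filter-split P? xs)

  ∃⊎∀ : ∀ {n a b} {A : Fin n → Set a} {B : Fin n → Set b} → (∀ k → A k ⊎ B k) → ∃ A ⊎ (∀ k → B k)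
  ∃⊎∀ {zero}  _   = inj₂ λ ()
  ∃⊎∀ {suc n} A⊎B with A⊎B zero | ∃⊎∀ (A⊎B ∘ suc)
  ... | inj₁ a | _            = inj₁ (zero , a)
  ... | inj₂ _ | inj₁ (k , a) = inj₁ (suc k , a)
  ... | inj₂ b | inj₂ bs      = inj₂ λ { zero → b ; (suc k) → bs k }

  ∈-oneTo⁻ : ∀ {M x} → x ∈ oneTo M → 1 ≤ x × x ≤ M
  ∈-oneTo⁻ x∈ with ∈-map⁻ suc x∈
  ... | _ , y∈ , refl = s≤s z≤n , ∈-upTo⁻ y∈

  ∈-oneTo⁺ : ∀ {M x} → 1 ≤ x → x ≤ M → x ∈ oneTo M
  ∈-oneTo⁺ {x = suc _} _ x≤M = ∈-map⁺ suc (∈-upTo⁺ x≤M)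

  unique-oneTo : ∀ M → Unique (oneTo M)
  unique-oneTo M = Unique.map⁺ suc-injective (Unique.upTo⁺ M)

  length-oneTo : ∀ M → length (oneTo M) ≡ M
  length-oneTo M = trans (length-map suc (upTo M)) (length-applyUpTo (λ x → x) M)

  x*[y*z]≡y*[x*z] : ∀ x y z → x * (y * z) ≡ y * (x * z)
  x*[y*z]≡y*[x*z] = solve-∀

  x*y*z≡x*z*y : ∀ x y z → (x * y) * z ≡ (x * z) * y
  x*y*z≡x*z*y = solve-∀

  *-pred-split : ∀ p K m .{{_ : NonZero p}} → (p * K) * m ≡ K * (pred p * m) + K * m
  *-pred-split (suc p) K m = begin
    (K + p * K) * m      ≡⟨ *-distribʳ-+ m K (p * K) ⟩
    K * m + p * K * m    ≡⟨ cong (K * m +_) (trans (cong (_* m) (*-comm p K)) (*-assoc K p m)) ⟩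
    K * m + K * (p * m)  ≡⟨ +-comm (K * m) (K * (p * m)) ⟩
    K * (p * m) + K * m  ∎
    where open ≡-Reasoning

  *∣*⇔ : ∀ t p x .{{_ : NonZero p}} → t * p ∣ p * x ⇔ t ∣ x
  *∣*⇔ t p x = mk⇔ (λ h → *-cancelʳ-∣ p (subst (t * p ∣_) (*-comm p x) h))
                   (λ h → subst (t * p ∣_) (*-comm x p) (*-monoˡ-∣ p h))

  coprime-∣*⇔ : ∀ {t p} x → Coprime t p → t ∣ p * x ⇔ t ∣ x
  coprime-∣*⇔ {p = p} x t⊥p = mk⇔ (coprime-divisor t⊥p) (λ t∣x → ∣-trans t∣x (n∣m*n p))

  additiveOrder : ∀ n d .{{_ : NonZero n}} → ∃ λ t → ∀ x → n ∣ d * x ⇔ t ∣ x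
  additiveOrder n d = n / g , λ x → mk⇔ (into x) (onto x)
    where
    g = gcd n d
    instance
      g≢0 : NonZero g
      g≢0 = ≢-nonZero (gcd[m,n]≢0 n d (inj₁ (≢-nonZero⁻¹ n)))
    n≡[n/g]*g : n / g * g ≡ n
    n≡[n/g]*g = m/n*n≡m (gcd[m,n]∣m n d)
    d*x≡[d/g]*x*g : ∀ x → d * x ≡ (d / g * x) * g
    d*x≡[d/g]*x*g x = trans (cong (_* x) (sym (m/n*n≡m (gcd[m,n]∣n n d)))) (x*y*z≡x*z*y (d / g) g x)
    into : ∀ x → n ∣ d * x → n / g ∣ x
    into x n∣dx = coprime-divisor (coprime-/gcd n d) (*-cancelʳ-∣ g (subst₂ _∣_ (sym n≡[n/g]*g) (d*x≡[d/g]*x*g x) n∣dx))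
    onto : ∀ x → n / g ∣ x → n ∣ d * x
    onto x t∣x = subst₂ _∣_ n≡[n/g]*g (sym (d*x≡[d/g]*x*g x)) (*-monoˡ-∣ g (∣-trans t∣x (n∣m*n (d / g))))

  ∣p*n⇒∣n : ∀ {p q} n → Prime p → Prime q → q ≢ p → q ∣ p * n → q ∣ n
  ∣p*n⇒∣n {p} n p-prime q-prime q≢p q∣pn with euclidsLemma p n q-prime q∣pn
  ... | inj₂ q∣n = q∣n
  ... | inj₁ q∣p with prime⇒irreducible p-prime q∣p
  ...   | inj₁ refl = contradiction q-prime ¬prime[1]
  ...   | inj₂ q≡p  = contradiction q≡p q≢p

  ∣*prime⇔ : ∀ {p q} t → Prime p → Prime q → q ≢ p → q ∣ t * p ⇔ q ∣ t
  ∣*prime⇔ {p} {q} t p-prime q-prime q≢p =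
    mk⇔ (λ q∣tp → ∣p*n⇒∣n t p-prime q-prime q≢p (subst (q ∣_) (*-comm t p) q∣tp)) (λ q∣t → ∣-trans q∣t (m∣m*n p))

  prime∤⇒coprime : ∀ {p n} → Prime p → ¬ p ∣ n → Coprime p n
  prime∤⇒coprime p-prime p∤n (i∣p , i∣n) with prime⇒irreducible p-prime i∣p
  ... | inj₁ i≡1 = i≡1
  ... | inj₂ refl = contradiction i∣n p∤n

  coprime⇒*∣ : ∀ {m n x} → Coprime m n → m ∣ x → n ∣ x → m * n ∣ x
  coprime⇒*∣ {m} {n} m⊥n m∣x (divides k refl) with coprime-divisor m⊥n (subst (m ∣_) (*-comm k n) m∣x)
  ... | divides l refl = divides l (*-assoc l m n)

  primeFactor : ∀ {g} .{{_ : NonZero g}} → g ≢ 1 → ∃ λ q → Prime q × q ∣ g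
  primeFactor {g} g≢1 with factorise g
  ... | record { factors = [] ; isFactorisation = g≡1 } = contradiction g≡1 g≢1
  ... | record { factors = q ∷ qs ; isFactorisation = g≡∏ ; factorsPrime = q-prime ∷ _ } =
    q , q-prime , subst (q ∣_) (sym g≡∏) (m∣m*n (product qs))

  DistinctPrimes : List ℕ → Set
  DistinctPrimes L = Unique L × All Prime L

  product∣ : ∀ {L x} → DistinctPrimes L → (∀ {p} → p ∈ L → p ∣ x) → product L ∣ x
  product∣ {[]}    {x} _ _ = 1∣ x
  product∣ {p ∷ L} (p∉L ∷ L! , p-prime ∷ L-prime) L∣x =
    coprime⇒*∣ (prime∤⇒coprime p-prime p∤∏L) (L∣x (here refl)) (product∣ (L! , L-prime) (L∣x ∘ there))
    where
    p∤∏L : ¬ p ∣ product L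
    p∤∏L p∣∏L = All.lookup p∉L (factorisationHasAllPrimeFactors p-prime p∣∏L L-prime) refl

  ∣product-filter⇔ : ∀ {r} {P : Pred ℕ r} (P? : Decidable P) {L p} → All Prime L → p ∈ L →
                     p ∣ product (filter P? L) ⇔ P p
  ∣product-filter⇔ P? {L} L-prime p∈L = mk⇔
    (λ p∣∏ → proj₂ (∈-filter⁻ P? {xs = L} (factorisationHasAllPrimeFactors (All.lookup L-prime p∈L) p∣∏
                                            (All-filter⁺ P? L-prime))))
    (λ Pp → ∈⇒∣product (∈-filter⁺ P? p∈L Pp))

  product-filter∣product : ∀ {r} {P : Pred ℕ r} (P? : Decidable P) {L} → DistinctPrimes L → product (filter P? L) ∣ product L
  product-filter∣product P? {L} (L! , L-prime) =
    product∣ (Unique.filter⁺ P? L! , All-filter⁺ P? L-prime) (λ p∈ → ∈⇒∣product (proj₁ (∈-filter⁻ P? {xs = L} p∈)))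

  -- Sieving out a list of primes

  NoDivisorIn : List ℕ → ℕ → Set
  NoDivisorIn L a = All (λ q → ¬ q ∣ a) L

  noDivisorIn? : ∀ L → Decidable (NoDivisorIn L)
  noDivisorIn? L a = All.all? (λ q → ¬? (q ∣? a)) L

  sieve : List ℕ → ℕ → List ℕ
  sieve L M = filter (noDivisorIn? L) (oneTo M)

  unique-sieve : ∀ L M → Unique (sieve L M)
  unique-sieve L M = Unique.filter⁺ (noDivisorIn? L) (unique-oneTo M)

  sieve-[] : ∀ M → sieve [] M ≡ oneTo M
  sieve-[] M = filter-all (noDivisorIn? []) (All.universal (λ _ → []) (oneTo M))

  sieve-split : ∀ {p L} M → DistinctPrimes (p ∷ L) →
                sieve L (p * M) ↭ sieve (p ∷ L) (p * M) ++ map (p *_) (sieve L M)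
  sieve-split {p} {L} M (p∉L ∷ _ , p-prime ∷ L-prime) =
    unique-⇔⇒↭ (unique-sieve L (p * M)) split-unique (mk⇔ into onto)
    where
    instance p≢0 = prime⇒nonZero p-prime

    disjoint : ∀ {v} → ¬ (v ∈ sieve (p ∷ L) (p * M) × v ∈ map (p *_) (sieve L M))
    disjoint (v∈ , v∈p*) with ∈-filter⁻ (noDivisorIn? (p ∷ L)) {xs = oneTo (p * M)} v∈ | ∈-map⁻ (p *_) v∈p*
    ... | _ , p∤v ∷ _ | b , _ , refl = p∤v (m∣m*n b)

    split-unique : Unique (sieve (p ∷ L) (p * M) ++ map (p *_) (sieve L M))
    split-unique = Unique.++⁺ (unique-sieve (p ∷ L) (p * M))
                        (Unique.map⁺ (λ {x} {y} → *-cancelˡ-≡ x y p) (unique-sieve L M)) disjoint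

    into : ∀ {x} → x ∈ sieve L (p * M) → x ∈ sieve (p ∷ L) (p * M) ++ map (p *_) (sieve L M)
    into {x} x∈ with ∈-filter⁻ (noDivisorIn? L) {xs = oneTo (p * M)} x∈ | p ∣? x
    ... | x∈oneTo , L∤x | no p∤x = ∈-++⁺ˡ (∈-filter⁺ (noDivisorIn? (p ∷ L)) x∈oneTo (p∤x ∷ L∤x))
    ... | x∈oneTo , L∤x | yes (divides b refl) =
      ∈-++⁺ʳ (sieve (p ∷ L) (p * M)) (subst (_∈ map (p *_) (sieve L M)) (*-comm p b)
        (∈-map⁺ (p *_) (∈-filter⁺ (noDivisorIn? L) (∈-oneTo⁺ 1≤b b≤M) L∤b)))
      where
      1≤b : 1 ≤ b
      1≤b = >-nonZero⁻¹ b {{m*n≢0⇒m≢0 b {{≢-nonZero (m<n⇒n≢0 (proj₁ (∈-oneTo⁻ x∈oneTo)))}}}}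
      b≤M : b ≤ M
      b≤M = *-cancelˡ-≤ p (subst (_≤ p * M) (*-comm b p) (proj₂ (∈-oneTo⁻ x∈oneTo)))
      L∤b : NoDivisorIn L b
      L∤b = All.map (λ q∤bp q∣b → q∤bp (∣-trans q∣b (m∣m*n p))) L∤x

    onto : ∀ {x} → x ∈ sieve (p ∷ L) (p * M) ++ map (p *_) (sieve L M) → x ∈ sieve L (p * M)
    onto x∈ with ∈-++⁻ (sieve (p ∷ L) (p * M)) x∈
    ... | inj₁ x∈s with ∈-filter⁻ (noDivisorIn? (p ∷ L)) {xs = oneTo (p * M)} x∈s
    ...   | x∈oneTo , _ ∷ L∤x = ∈-filter⁺ (noDivisorIn? L) x∈oneTo L∤x
    onto x∈ | inj₂ x∈p* with ∈-map⁻ (p *_) x∈p*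
    ... | b , b∈ , refl with ∈-filter⁻ (noDivisorIn? L) {xs = oneTo M} b∈
    ...   | b∈oneTo , L∤b = ∈-filter⁺ (noDivisorIn? L) (∈-oneTo⁺ 1≤pb pb≤pM) L∤pb
      where
      1≤pb : 1 ≤ p * b
      1≤pb = *-mono-≤ (>-nonZero⁻¹ p) (proj₁ (∈-oneTo⁻ b∈oneTo))
      pb≤pM : p * b ≤ p * M
      pb≤pM = *-monoʳ-≤ p (proj₂ (∈-oneTo⁻ b∈oneTo))
      L∤pb : NoDivisorIn L (p * b)
      L∤pb = All.tabulate λ q∈L q∣pb → All.lookup L∤b q∈L
        (∣p*n⇒∣n b p-prime (All.lookup L-prime q∈L) (≢-sym (All.lookup p∉L q∈L)) q∣pb)

  ∏pred : List ℕ → ℕ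
  ∏pred L = product (map pred L)

  length-sieve : ∀ {L} → DistinctPrimes L → ∀ K → length (sieve L (K * product L)) ≡ K * ∏pred L
  length-sieve {[]} _ K = trans (cong length (sieve-[] (K * 1))) (length-oneTo (K * 1))
  length-sieve {p ∷ L} ps@(_ ∷ L! , p-prime ∷ L-prime) K = +-cancelʳ-≡ (K * m) _ _ (begin
    length (sieve (p ∷ L) (K * (p * P))) + K * m
      ≡⟨ cong₂ _+_ (cong (length ∘ sieve (p ∷ L)) (x*[y*z]≡y*[x*z] K p P)) (sym (length-sieve L-ps K)) ⟩
    length (sieve (p ∷ L) (p * (K * P))) + length (sieve L (K * P))
      ≡⟨ cong (length (sieve (p ∷ L) (p * (K * P))) +_) (sym (length-map (p *_) (sieve L (K * P)))) ⟩
    length (sieve (p ∷ L) (p * (K * P))) + length (map (p *_) (sieve L (K * P)))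
      ≡⟨ sym (trans (↭-length (sieve-split (K * P) ps)) (length-++ (sieve (p ∷ L) (p * (K * P))))) ⟩
    length (sieve L (p * (K * P)))
      ≡⟨ cong (length ∘ sieve L) (sym (*-assoc p K P)) ⟩
    length (sieve L ((p * K) * P))
      ≡⟨ length-sieve L-ps (p * K) ⟩
    (p * K) * m
      ≡⟨ *-pred-split p K m {{prime⇒nonZero p-prime}} ⟩
    K * (pred p * m) + K * m ∎)
    where
    open ≡-Reasoning
    P = product L
    m = ∏pred L
    L-ps : DistinctPrimes L
    L-ps = L! , L-prime

  coprimesUpTo : ℕ → List ℕ
  coprimesUpTo M = filter (λ a → gcd a M ≟ 1) (oneTo M)

  coprimesUpTo≡sieve : ∀ {L} M .{{_ : NonZero M}} → All Prime L → (∀ {q} → Prime q → q ∣ M ⇔ q ∈ L) →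
                       coprimesUpTo M ≡ sieve L M
  coprimesUpTo≡sieve {L} M L-prime primesOfM =
    filter-≐ (λ a → gcd a M ≟ 1) (noDivisorIn? L) ((λ {a} → coprime⇒noDivisor a) , (λ {a} → noDivisor⇒coprime a)) (oneTo M)
    where
    coprime⇒noDivisor : ∀ a → gcd a M ≡ 1 → NoDivisorIn L a
    coprime⇒noDivisor a gcd≡1 = All.tabulate λ q∈L q∣a →
      let q-prime = All.lookup L-prime q∈L
          q∣gcd   = gcd-greatest q∣a (from (primesOfM q-prime) q∈L)
      in ¬prime[1] (subst Prime (∣1⇒≡1 (subst (_ ∣_) gcd≡1 q∣gcd)) q-prime)
    noDivisor⇒coprime : ∀ a → NoDivisorIn L a → gcd a M ≡ 1
    noDivisor⇒coprime a L∤a with gcd a M ≟ 1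
    ... | yes gcd≡1 = gcd≡1
    ... | no gcd≢1 with primeFactor {{≢-nonZero (gcd[m,n]≢0 a M (inj₂ (≢-nonZero⁻¹ M)))}} gcd≢1
    ...   | q , q-prime , q∣gcd = contradiction (∣-trans q∣gcd (gcd[m,n]∣m a M))
                                    (All.lookup L∤a (to (primesOfM q-prime) (∣-trans q∣gcd (gcd[m,n]∣n a M))))

  φ-product : ∀ {L} → DistinctPrimes L → φ (product L) ≡ ∏pred L
  φ-product {L} ps@(_ , L-prime) = begin
    φ (product L)                     ≡⟨ cong length (coprimesUpTo≡sieve (product L) {{productOfPrimes≢0 L-prime}} L-prime primesOf∏) ⟩
    length (sieve L (product L))      ≡⟨ cong (length ∘ sieve L) (sym (*-identityˡ (product L))) ⟩
    length (sieve L (1 * product L))  ≡⟨ length-sieve ps 1 ⟩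
    1 * ∏pred L                       ≡⟨ *-identityˡ (∏pred L) ⟩
    ∏pred L                           ∎
    where
    open ≡-Reasoning
    primesOf∏ : ∀ {q} → Prime q → q ∣ product L ⇔ q ∈ L
    primesOf∏ q-prime = mk⇔ (λ q∣∏ → factorisationHasAllPrimeFactors q-prime q∣∏ L-prime) ∈⇒∣product

  ∈-primeDivisors⁻ : ∀ {n p} → p ∈ primeDivisors n → Prime p × p ∣ n
  ∈-primeDivisors⁻ {n} p∈ = proj₂ (∈-filter⁻ (λ p → prime? p ×-dec (p ∣? n)) {xs = oneTo n} p∈)

  ∈-primeDivisors⁺ : ∀ {n p} .{{_ : NonZero n}} → Prime p → p ∣ n → p ∈ primeDivisors n
  ∈-primeDivisors⁺ {n} p-prime p∣n = ∈-filter⁺ (λ p → prime? p ×-dec (p ∣? n))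
    (∈-oneTo⁺ (>-nonZero⁻¹ _ {{prime⇒nonZero p-prime}}) (∣⇒≤ p∣n)) (p-prime , p∣n)

  primeDivisors-distinct : ∀ n → DistinctPrimes (primeDivisors n)
  primeDivisors-distinct n = Unique.filter⁺ _ (unique-oneTo n) , All.tabulate (λ p∈ → proj₁ (∈-primeDivisors⁻ {n} p∈))

  rad∣n : ∀ n → rad n ∣ n
  rad∣n n = product∣ (primeDivisors-distinct n) (λ p∈ → proj₂ (∈-primeDivisors⁻ {n} p∈))

  nOverRad*rad≡n : ∀ n → nOverRad n * rad n ≡ n
  nOverRad*rad≡n n with rad n | rad∣n n | productOfPrimes≥1 (proj₂ (primeDivisors-distinct n))
  ... | suc _ | rad∣n | _ = m/n*n≡m rad∣n

  nOverRad≢0 : ∀ n .{{_ : NonZero n}} → NonZero (nOverRad n)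
  nOverRad≢0 n = m*n≢0⇒m≢0 (nOverRad n) {{≢-nonZero (λ eq → ≢-nonZero⁻¹ n (trans (sym (nOverRad*rad≡n n)) eq))}}

  nOverRad∤⇒∤rad : ∀ n d {t} .{{_ : NonZero n}} → (∀ x → n ∣ d * x ⇔ t ∣ x) → ¬ nOverRad n ∣ d → ¬ t ∣ rad n
  nOverRad∤⇒∤rad n d t-spec N∤d t∣rad = N∤d (*-cancelʳ-∣ (rad n) {{productOfPrimes≢0 (proj₂ (primeDivisors-distinct n))}}
    (subst (_∣ d * rad n) (sym (nOverRad*rad≡n n)) (from (t-spec (rad n)) t∣rad)))

  primeDivisors-gcd : ∀ q n .{{_ : NonZero n}} → primeDivisors (gcd q n) ↭ filter (_∣? q) (primeDivisors n)
  primeDivisors-gcd q n = unique-⇔⇒↭ (proj₁ (primeDivisors-distinct (gcd q n)))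
    (Unique.filter⁺ (_∣? q) (proj₁ (primeDivisors-distinct n))) (mk⇔ into onto)
    where
    instance
      gcd≢0 : NonZero (gcd q n)
      gcd≢0 = ≢-nonZero (gcd[m,n]≢0 q n (inj₂ (≢-nonZero⁻¹ n)))
    into : ∀ {p} → p ∈ primeDivisors (gcd q n) → p ∈ filter (_∣? q) (primeDivisors n)
    into p∈ with ∈-primeDivisors⁻ p∈
    ... | p-prime , p∣gcd = ∈-filter⁺ (_∣? q) (∈-primeDivisors⁺ p-prime (∣-trans p∣gcd (gcd[m,n]∣n q n)))
                                               (∣-trans p∣gcd (gcd[m,n]∣m q n))
    onto : ∀ {p} → p ∈ filter (_∣? q) (primeDivisors n) → p ∈ primeDivisors (gcd q n)
    onto p∈ with ∈-filter⁻ (_∣? q) {xs = primeDivisors n} p∈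
    ... | p∈n , p∣q with ∈-primeDivisors⁻ {n} p∈n
    ...   | p-prime , p∣n = ∈-primeDivisors⁺ p-prime (gcd-greatest p∣q p∣n)

  primesNotDividing : ℕ → List ℕ → List ℕ
  primesNotDividing q L = filter (λ p → ¬? (p ∣? q)) L

  product∣*⇔ : ∀ {L} q x → DistinctPrimes L → product L ∣ q * x ⇔ product (primesNotDividing q L) ∣ x
  product∣*⇔ {L} q x (L! , L-prime) = mk⇔ into onto
    where
    into : product L ∣ q * x → product (primesNotDividing q L) ∣ x
    into ∏∣qx = product∣ (Unique.filter⁺ _ L! , All-filter⁺ _ L-prime) λ p∈ →
      let p∈L , p∤q = ∈-filter⁻ (λ p → ¬? (p ∣? q)) {xs = L} p∈ in
      fromInj₂ (λ p∣q → contradiction p∣q p∤q) (euclidsLemma q x (All.lookup L-prime p∈L) (∣-trans (∈⇒∣product p∈L) ∏∣qx))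
    onto : product (primesNotDividing q L) ∣ x → product L ∣ q * x
    onto t∣x = product∣ (L! , L-prime) L∣qx
      where
      L∣qx : ∀ {p} → p ∈ L → p ∣ q * x
      L∣qx {p} p∈L with p ∣? q
      ... | yes p∣q = ∣-trans p∣q (m∣m*n x)
      ... | no p∤q  = ∣-trans (∣-trans (∈⇒∣product (∈-filter⁺ (λ p → ¬? (p ∣? q)) p∈L p∤q)) t∣x) (n∣m*n q)

  n∣q*nOverRad*x⇔ : ∀ n q x .{{_ : NonZero n}} →
                    n ∣ (q * nOverRad n) * x ⇔ product (primesNotDividing q (primeDivisors n)) ∣ x
  n∣q*nOverRad*x⇔ n q x = mk⇔ (to rad∣⇔ ∘ cancel) (uncancel ∘ from rad∣⇔)
    where
    N = nOverRad n
    instance N≢0 = nOverRad≢0 n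
    rad∣⇔ = product∣*⇔ q x (primeDivisors-distinct n)
    n≡N*rad : n ≡ N * rad n
    n≡N*rad = sym (nOverRad*rad≡n n)
    reassoc : (q * N) * x ≡ N * (q * x)
    reassoc = trans (cong (_* x) (*-comm q N)) (*-assoc N q x)
    cancel : n ∣ (q * N) * x → rad n ∣ q * x
    cancel h = *-cancelˡ-∣ N (subst₂ _∣_ n≡N*rad reassoc h)
    uncancel : rad n ∣ q * x → n ∣ (q * N) * x
    uncancel h = subst₂ _∣_ (sym n≡N*rad) (sym reassoc) (*-monoʳ-∣ N h)

  filter-∣-primesNotDividing : ∀ q {L} → All Prime L → filter (_∣? product (primesNotDividing q L)) L ≡ primesNotDividing q L
  filter-∣-primesNotDividing q L-prime =
    filter-cong _ _ (All.tabulate (∣product-filter⇔ (λ p → ¬? (p ∣? q)) L-prime))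

  primesNotDividing-primesNotDividing : ∀ q {L} → All Prime L →
                                        primesNotDividing (product (primesNotDividing q L)) L ≡ filter (_∣? q) L
  primesNotDividing-primesNotDividing q L-prime = filter-cong _ _ (All.tabulate λ p∈L →
    ⇔.trans (¬-cong-⇔ (∣product-filter⇔ (λ p → ¬? (p ∣? q)) L-prime p∈L)) (mk⇔ (decidable-stable (_ ∣? q)) (λ p∣q p∤q → p∤q p∣q)))

  ω-split : ∀ q n .{{_ : NonZero n}} → ω n ≡ length (primesNotDividing q (primeDivisors n)) + ω (gcd q n)
  ω-split q n = trans (length-filter-split (_∣? q) (primeDivisors n))
                      (cong (length (primesNotDividing q (primeDivisors n)) +_) (sym (↭-length (primeDivisors-gcd q n))))

  φ-rad-gcd : ∀ q n .{{_ : NonZero n}} → φ (rad (gcd q n)) ≡ ∏pred (filter (_∣? q) (primeDivisors n))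
  φ-rad-gcd q n = trans (φ-product (primeDivisors-distinct (gcd q n))) (product-↭ (map⁺ pred (primeDivisors-gcd q n)))

module RootsOfUnity {c ℓ} (R : CommutativeRing c ℓ) where
  open CommutativeRing R
  open import Algebra.Properties.Ring ring
    using (-‿+-comm; -‿involutive; -‿distribʳ-*; -0#≈0#; x+x≈x⇒x≈0; +-inverseˡ-unique; +-inverseʳ-unique;
           +-cancelʳ; x∙y⁻¹≈ε⇒x≈y)
  open import Algebra.Properties.CommutativeSemiring.Exp commutativeSemiring
    using (_^_; ^-congˡ; ^-assocʳ; ^-homo-*; ^-distrib-*)
  open import Algebra.Properties.Semiring.Sum semiring
    using (sum; sum-syntax; ∑-comm; *-distribˡ-sum; sum-cong-≋; sum-replicate-zero)
  open import Data.Nat as ℕ using (ℕ; zero; suc; NonZero; ∣_-_∣)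
  import Data.Nat.Properties as ℕ
  open import Data.Nat.Divisibility using (_∣_; _∣?_; divides; ∣-trans; n∣m*n; m%n≡0⇒n∣m)
  open import Data.Nat.DivMod using (_%_; _/_; m%n<n; m≡m%n+[m/n]*n; m/n<m; m/n*n≡m; m*[n/m]≡n)
  open import Data.Nat.GCD using (gcd; gcd[m,n]∣m; gcd[m,n]∣n; gcd[m,n]≢0; n/gcd[m,n]≢0)
  import Data.Nat.Coprimality as Coprime
  open import Data.Nat.Primality using (prime⇒nonZero)
  open import Data.Nat.Primality.Factorisation using (factorisationHasAllPrimeFactors)
  open import Data.Nat.ListAction using (product)
  open import Data.Fin as Fin using (Fin; toℕ)
  open import Data.Fin.Properties using (toℕ<n; toℕ≤n)
  open import Data.List using (List; []; _∷_; _++_; map; applyUpTo; tabulate; upTo; filter; length)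
  open import Data.List.Properties using (filter-accept; filter-reject; length-tabulate)
  open import Data.List.Membership.Propositional using (_∈_)
  open import Data.List.Membership.Propositional.Properties using (∈-filter⁺; ∈-tabulate⁻)
  open import Data.List.Relation.Unary.All as All using (_∷_)
  open import Data.List.Relation.Unary.Unique.Propositional using (_∷_)
  import Data.List.Relation.Unary.Unique.Propositional.Properties as Unique
  open import Data.List.Relation.Binary.Permutation.Propositional as Perm using (_↭_)
  open import Data.Product using (_×_; _,_; proj₁; proj₂; ∃)
  open import Data.Sum as Sum using (_⊎_; inj₁; inj₂; fromInj₂)
  open import Function using (_∘_; _⇔_; mk⇔; Equivalence)
  open import Function.Definitions using (Injective)
  import Function.Properties.Equivalence as ⇔
  open import Function.Related.TypeIsomorphisms using (¬-cong-⇔)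
  open import Relation.Nullary using (¬_; Dec; yes; no; ¬?; contradiction)
  import Relation.Binary.PropositionalEquality as ≡
  open import Relation.Binary.PropositionalEquality using (≢-sym)
  open import Relation.Binary.Reasoning.Setoid setoid
  open Equivalence using (to; from)
  open NumberTheory

  pow≡^ : ∀ x k → pow R x k ≡.≡ x ^ k
  pow≡^ x zero    = ≡.refl
  pow≡^ x (suc k) = ≡.cong (x *_) (pow≡^ x k)

  sumFin≡sum : ∀ m (g : Fin m → Carrier) → sumFin R m g ≡.≡ sum g
  sumFin≡sum zero    g = ≡.refl
  sumFin≡sum (suc m) g = ≡.cong (g Fin.zero +_) (sumFin≡sum m (g ∘ Fin.suc))

  1^k≈1 : ∀ k → 1# ^ k ≈ 1#
  1^k≈1 zero    = refl
  1^k≈1 (suc k) = trans (*-identityˡ _) (1^k≈1 k)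

  [x^a]^b≈[x^b]^a : ∀ x a b → (x ^ a) ^ b ≈ (x ^ b) ^ a
  [x^a]^b≈[x^b]^a x a b = begin
    (x ^ a) ^ b   ≈⟨ ^-assocʳ x a b ⟩
    x ^ (a ℕ.* b) ≡⟨ ≡.cong (x ^_) (ℕ.*-comm a b) ⟩
    x ^ (b ℕ.* a) ≈⟨ sym (^-assocʳ x b a) ⟩
    (x ^ b) ^ a   ∎

  fromℕ-+ : ∀ a b → fromℕ R (a ℕ.+ b) ≈ fromℕ R a + fromℕ R b
  fromℕ-+ zero    b = sym (+-identityˡ _)
  fromℕ-+ (suc a) b = trans (+-congˡ (fromℕ-+ a b)) (sym (+-assoc 1# _ _))

  ∑1≈fromℕ : ∀ m → ∑[ k < m ] 1# ≈ fromℕ R m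
  ∑1≈fromℕ zero    = refl
  ∑1≈fromℕ (suc m) = +-congˡ (∑1≈fromℕ m)

  ∑-zero : ∀ m {f : Fin m → Carrier} → (∀ k → f k ≈ 0#) → ∑[ k < m ] f k ≈ 0#
  ∑-zero m f≈0 = trans (sum-cong-≋ {m} f≈0) (sum-replicate-zero m)

  negPow-cong : ∀ s {x y} → x ≈ y → negPow R s x ≈ negPow R s y
  negPow-cong zero    x≈y = x≈y
  negPow-cong (suc s) x≈y = -‿cong (negPow-cong s x≈y)

  negPow-+ : ∀ s x y → negPow R s (x + y) ≈ negPow R s x + negPow R s y
  negPow-+ zero    x y = refl
  negPow-+ (suc s) x y = trans (-‿cong (negPow-+ s x y)) (sym (-‿+-comm _ _))

  negPow-+-double : ∀ s b x → negPow R (s ℕ.+ (b ℕ.+ b)) x ≈ negPow R s x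
  negPow-+-double s zero    x = reflexive (≡.cong (λ k → negPow R k x) (ℕ.+-identityʳ s))
  negPow-+-double s (suc b) x = begin
    negPow R (s ℕ.+ (suc b ℕ.+ suc b)) x   ≡⟨ ≡.cong (λ k → negPow R k x) (s+[1+b+1+b]≡2+s+[b+b] s b) ⟩
    - - negPow R (s ℕ.+ (b ℕ.+ b)) x       ≈⟨ -‿involutive _ ⟩
    negPow R (s ℕ.+ (b ℕ.+ b)) x           ≈⟨ negPow-+-double s b x ⟩
    negPow R s x                           ∎
    where
    open import Data.Nat.Tactic.RingSolver using (solve-∀)
    s+[1+b+1+b]≡2+s+[b+b] : ∀ s b → s ℕ.+ (suc b ℕ.+ suc b) ≡.≡ suc (suc (s ℕ.+ (b ℕ.+ b)))
    s+[1+b+1+b]≡2+s+[b+b] = solve-∀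

  sumList : (ℕ → Carrier) → List ℕ → Carrier
  sumList h []       = 0#
  sumList h (x ∷ xs) = h x + sumList h xs

  sumList-++ : ∀ h xs ys → sumList h (xs ++ ys) ≈ sumList h xs + sumList h ys
  sumList-++ h []       ys = sym (+-identityˡ _)
  sumList-++ h (x ∷ xs) ys = trans (+-congˡ (sumList-++ h xs ys)) (sym (+-assoc _ _ _))

  sumList-map : ∀ h f xs → sumList h (map f xs) ≡.≡ sumList (h ∘ f) xs
  sumList-map h f []       = ≡.refl
  sumList-map h f (x ∷ xs) = ≡.cong (h (f x) +_) (sumList-map h f xs)

  sumList-cong : ∀ {h g} → (∀ x → h x ≈ g x) → ∀ xs → sumList h xs ≈ sumList g xs
  sumList-cong h≈g []       = refl
  sumList-cong h≈g (x ∷ xs) = +-cong (h≈g x) (sumList-cong h≈g xs)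

  sumList-↭ : ∀ h {xs ys} → xs ↭ ys → sumList h xs ≈ sumList h ys
  sumList-↭ h Perm.refl              = refl
  sumList-↭ h (Perm.prep x xs↭ys)    = +-congˡ (sumList-↭ h xs↭ys)
  sumList-↭ h (Perm.swap x y xs↭ys)  = begin
    h x + (h y + _) ≈⟨ sym (+-assoc _ _ _) ⟩
    h x + h y + _   ≈⟨ +-cong (+-comm (h x) (h y)) (sumList-↭ h xs↭ys) ⟩
    h y + h x + _   ≈⟨ +-assoc _ _ _ ⟩
    h y + (h x + _) ∎
  sumList-↭ h (Perm.trans xs↭ys ys↭zs) = trans (sumList-↭ h xs↭ys) (sumList-↭ h ys↭zs)

  sumList-applyUpTo : ∀ h f M → sumList h (applyUpTo f M) ≡.≡ ∑[ k < M ] h (f (toℕ k))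
  sumList-applyUpTo h f zero    = ≡.refl
  sumList-applyUpTo h f (suc M) = ≡.cong (h (f 0) +_) (sumList-applyUpTo h (f ∘ suc) M)

  sumList-tabulate : ∀ h {m} (a : Fin m → ℕ) → sumList h (tabulate a) ≡.≡ ∑[ k < m ] h (a k)
  sumList-tabulate h {zero}  a = ≡.refl
  sumList-tabulate h {suc m} a = ≡.cong (h (a Fin.zero) +_) (sumList-tabulate h (a ∘ Fin.suc))

  geometric-sum : ∀ x M → (x - 1#) * ∑[ k < M ] (x ^ toℕ k) ≈ x ^ M - 1#
  geometric-sum x zero    = trans (zeroʳ _) (sym (-‿inverseʳ 1#))
  geometric-sum x (suc M) = begin
    (x - 1#) * (1# + ∑[ k < M ] (x * x ^ toℕ k))  ≈⟨ *-congˡ (+-congˡ (sym (*-distribˡ-sum {M} x (λ k → x ^ toℕ k)))) ⟩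
    (x - 1#) * (1# + x * S)                      ≈⟨ distribˡ _ _ _ ⟩
    (x - 1#) * 1# + (x - 1#) * (x * S)           ≈⟨ +-cong (*-identityʳ _) (x*[y*z]≈y*[x*z] _ x S) ⟩
    (x - 1#) + x * ((x - 1#) * S)                ≈⟨ +-congˡ (*-congˡ (geometric-sum x M)) ⟩
    (x - 1#) + x * (x ^ M - 1#)                  ≈⟨ +-congˡ (trans (distribˡ x _ _) (+-congˡ (sym (-‿distribʳ-* x 1#)))) ⟩
    (x - 1#) + (x * x ^ M - x * 1#)              ≈⟨ +-congˡ (+-congˡ (-‿cong (*-identityʳ x))) ⟩
    (x - 1#) + (x * x ^ M - x)                   ≈⟨ +-comm _ _ ⟩
    (x * x ^ M - x) + (x - 1#)                   ≈⟨ +-assoc _ _ _ ⟩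
    x * x ^ M + (- x + (x - 1#))                 ≈⟨ +-congˡ (sym (+-assoc _ _ _)) ⟩
    x * x ^ M + ((- x + x) - 1#)                 ≈⟨ +-congˡ (trans (+-congʳ (-‿inverseˡ x)) (+-identityˡ _)) ⟩
    x * x ^ M - 1#                               ∎
    where
    S = ∑[ k < M ] (x ^ toℕ k)
    x*[y*z]≈y*[x*z] : ∀ a b c → a * (b * c) ≈ b * (a * c)
    x*[y*z]≈y*[x*z] a b c = trans (sym (*-assoc a b c)) (trans (*-congʳ (*-comm a b)) (*-assoc b a c))

  -- Sums of powers over a sieve

  sieveSum : List ℕ → ℕ → Carrier → Carrier
  sieveSum L M β = sumList (β ^_) (sieve L M)

  sieveSum-[] : ∀ M β → sieveSum [] M β ≡.≡ ∑[ k < M ] (β ^ suc (toℕ k))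
  sieveSum-[] M β = ≡.trans (≡.cong (sumList (β ^_)) (sieve-[] M))
    (≡.trans (sumList-map (β ^_) suc (upTo M)) (sumList-applyUpTo (λ x → β ^ suc x) (λ x → x) M))

  sieveSum-split : ∀ {p L} M β → DistinctPrimes (p ∷ L) →
                   sieveSum L (p ℕ.* M) β ≈ sieveSum (p ∷ L) (p ℕ.* M) β + sieveSum L M (β ^ p)
  sieveSum-split {p} {L} M β ps = begin
    sieveSum L (p ℕ.* M) β
      ≈⟨ sumList-↭ (β ^_) (sieve-split M ps) ⟩
    sumList (β ^_) (sieve (p ∷ L) (p ℕ.* M) ++ map (p ℕ.*_) (sieve L M))
      ≈⟨ sumList-++ (β ^_) (sieve (p ∷ L) (p ℕ.* M)) _ ⟩
    sieveSum (p ∷ L) (p ℕ.* M) β + sumList (β ^_) (map (p ℕ.*_) (sieve L M))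
      ≡⟨ ≡.cong (sieveSum (p ∷ L) (p ℕ.* M) β +_) (sumList-map (β ^_) (p ℕ.*_) (sieve L M)) ⟩
    sieveSum (p ∷ L) (p ℕ.* M) β + sumList (λ x → β ^ (p ℕ.* x)) (sieve L M)
      ≈⟨ +-congˡ (sumList-cong (λ x → sym (^-assocʳ β p x)) (sieve L M)) ⟩
    sieveSum (p ∷ L) (p ℕ.* M) β + sieveSum L M (β ^ p) ∎

  ramanujanValue : ℕ → List ℕ → ℕ → Carrier
  ramanujanValue K L t with t ∣? product L
  ... | yes _ = negPow R (length (filter (_∣? t) L)) (fromℕ R (K ℕ.* ∏pred (primesNotDividing t L)))
  ... | no _  = 0#

  ramanujanValue-∣ : ∀ K L {t} → t ∣ product L →
    ramanujanValue K L t ≡.≡ negPow R (length (filter (_∣? t) L)) (fromℕ R (K ℕ.* ∏pred (primesNotDividing t L)))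
  ramanujanValue-∣ K L {t} t∣∏ with t ∣? product L
  ... | yes _   = ≡.refl
  ... | no t∤∏ = contradiction t∣∏ t∤∏

  ramanujanValue-∤ : ∀ K L {t} → ¬ t ∣ product L → ramanujanValue K L t ≡.≡ 0#
  ramanujanValue-∤ K L {t} t∤∏ with t ∣? product L
  ... | yes t∣∏ = contradiction t∣∏ t∤∏
  ... | no _    = ≡.refl

  ramanujanValue-∤p : ∀ {p L} K t → DistinctPrimes (p ∷ L) → ¬ p ∣ t →
                      ramanujanValue (p ℕ.* K) L t ≈ ramanujanValue K (p ∷ L) t + ramanujanValue K L t
  ramanujanValue-∤p {p} {L} K t (_ , p-prime ∷ _) p∤t = cases (t ∣? product L)
    where
    cases : Dec (t ∣ product L) → ramanujanValue (p ℕ.* K) L t ≈ ramanujanValue K (p ∷ L) t + ramanujanValue K L t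
    cases (no t∤∏) = begin
      ramanujanValue (p ℕ.* K) L t                     ≡⟨ ramanujanValue-∤ (p ℕ.* K) L t∤∏ ⟩
      0#                                               ≈⟨ sym (+-identityʳ 0#) ⟩
      0# + 0#                                          ≡⟨ ≡.sym (≡.cong₂ _+_ (ramanujanValue-∤ K (p ∷ L) t∤p∏) (ramanujanValue-∤ K L t∤∏)) ⟩
      ramanujanValue K (p ∷ L) t + ramanujanValue K L t ∎
      where
      t∤p∏ : ¬ t ∣ p ℕ.* product L
      t∤p∏ = t∤∏ ∘ to (coprime-∣*⇔ (product L) (Coprime.sym (prime∤⇒coprime p-prime p∤t)))
    cases (yes t∣∏) = begin
      ramanujanValue (p ℕ.* K) L t
        ≡⟨ ramanujanValue-∣ (p ℕ.* K) L t∣∏ ⟩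
      negPow R s (fromℕ R ((p ℕ.* K) ℕ.* m))
        ≡⟨ ≡.cong (negPow R s ∘ fromℕ R) (*-pred-split p K m {{prime⇒nonZero p-prime}}) ⟩
      negPow R s (fromℕ R (K ℕ.* (ℕ.pred p ℕ.* m) ℕ.+ K ℕ.* m))
        ≈⟨ trans (negPow-cong s (fromℕ-+ (K ℕ.* (ℕ.pred p ℕ.* m)) (K ℕ.* m))) (negPow-+ s _ _) ⟩
      negPow R s (fromℕ R (K ℕ.* (ℕ.pred p ℕ.* m))) + negPow R s (fromℕ R (K ℕ.* m))
        ≡⟨ ≡.sym (≡.cong₂ _+_ (≡.trans (ramanujanValue-∣ K (p ∷ L) (∣-trans t∣∏ (n∣m*n p))) lists-p∷L) (ramanujanValue-∣ K L t∣∏)) ⟩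
      ramanujanValue K (p ∷ L) t + ramanujanValue K L t ∎
      where
      s = length (filter (_∣? t) L)
      m = ∏pred (primesNotDividing t L)
      lists-p∷L : negPow R (length (filter (_∣? t) (p ∷ L))) (fromℕ R (K ℕ.* ∏pred (primesNotDividing t (p ∷ L))))
                  ≡.≡ negPow R s (fromℕ R (K ℕ.* (ℕ.pred p ℕ.* m)))
      lists-p∷L = ≡.cong₂ (λ A B → negPow R (length A) (fromℕ R (K ℕ.* ∏pred B)))
                    (filter-reject (_∣? t) p∤t) (filter-accept (λ q → ¬? (q ∣? t)) p∤t)

  ramanujanValue-∣p : ∀ {p L} K t₀ → DistinctPrimes (p ∷ L) →
                      ramanujanValue K (p ∷ L) (t₀ ℕ.* p) ≈ - ramanujanValue K L t₀
  ramanujanValue-∣p {p} {L} K t₀ (p∉L ∷ _ , p-prime ∷ L-prime) = cases (t₀ ∣? product L)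
    where
    cases : Dec (t₀ ∣ product L) → ramanujanValue K (p ∷ L) (t₀ ℕ.* p) ≈ - ramanujanValue K L t₀
    cases (no t₀∤∏) = begin
      ramanujanValue K (p ∷ L) (t₀ ℕ.* p)  ≡⟨ ramanujanValue-∤ K (p ∷ L) (t₀∤∏ ∘ to (*∣*⇔ t₀ p (product L))) ⟩
      0#                                   ≈⟨ sym -0#≈0# ⟩
      - 0#                                 ≡⟨ ≡.cong -_ (≡.sym (ramanujanValue-∤ K L t₀∤∏)) ⟩
      - ramanujanValue K L t₀              ∎
      where instance p≢0 = prime⇒nonZero p-prime
    cases (yes t₀∣∏) = begin
      ramanujanValue K (p ∷ L) (t₀ ℕ.* p)
        ≡⟨ ramanujanValue-∣ K (p ∷ L) (from (*∣*⇔ t₀ p (product L)) t₀∣∏) ⟩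
      negPow R (length (filter (_∣? t₀ ℕ.* p) (p ∷ L))) (fromℕ R (K ℕ.* ∏pred (primesNotDividing (t₀ ℕ.* p) (p ∷ L))))
        ≡⟨ ≡.cong₂ (λ A B → negPow R (length A) (fromℕ R (K ℕ.* ∏pred B))) divisors nonDivisors ⟩
      - negPow R (length (filter (_∣? t₀) L)) (fromℕ R (K ℕ.* ∏pred (primesNotDividing t₀ L)))
        ≡⟨ ≡.cong -_ (≡.sym (ramanujanValue-∣ K L t₀∣∏)) ⟩
      - ramanujanValue K L t₀ ∎
      where
      instance p≢0 = prime⇒nonZero p-prime
      ∣t₀p⇔∣t₀ : ∀ {q} → q ∈ L → q ∣ t₀ ℕ.* p ⇔ q ∣ t₀
      ∣t₀p⇔∣t₀ q∈L = ∣*prime⇔ t₀ p-prime (All.lookup L-prime q∈L) (≢-sym (All.lookup p∉L q∈L))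
      divisors : filter (_∣? t₀ ℕ.* p) (p ∷ L) ≡.≡ p ∷ filter (_∣? t₀) L
      divisors = ≡.trans (filter-accept (_∣? t₀ ℕ.* p) (n∣m*n t₀))
                         (≡.cong (p ∷_) (filter-cong (_∣? t₀ ℕ.* p) (_∣? t₀) (All.tabulate ∣t₀p⇔∣t₀)))
      nonDivisors : primesNotDividing (t₀ ℕ.* p) (p ∷ L) ≡.≡ primesNotDividing t₀ L
      nonDivisors = ≡.trans (filter-reject (λ q → ¬? (q ∣? t₀ ℕ.* p)) (λ p∤t₀p → p∤t₀p (n∣m*n t₀)))
                            (filter-cong _ _ (All.tabulate (¬-cong-⇔ ∘ ∣t₀p⇔∣t₀)))

  ramanujanValue-primesNotDividing : ∀ K q n .{{_ : NonZero n}} →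
    ramanujanValue K (primeDivisors n) (product (primesNotDividing q (primeDivisors n)))
      ≈ negPow R (ω n ℕ.+ ω (gcd q n)) (fromℕ R (K ℕ.* φ (rad (gcd q n))))
  ramanujanValue-primesNotDividing K q n = begin
    ramanujanValue K Pn (product (primesNotDividing q Pn))
      ≡⟨ ramanujanValue-∣ K Pn (product-filter∣product _ (primeDivisors-distinct n)) ⟩
    negPow R (length (filter (_∣? product (primesNotDividing q Pn)) Pn))
             (fromℕ R (K ℕ.* ∏pred (primesNotDividing (product (primesNotDividing q Pn)) Pn)))
      ≡⟨ ≡.cong₂ (λ A B → negPow R (length A) (fromℕ R (K ℕ.* ∏pred B)))
                 (filter-∣-primesNotDividing q Pn-prime) (primesNotDividing-primesNotDividing q Pn-prime) ⟩
    negPow R a (fromℕ R (K ℕ.* ∏pred (filter (_∣? q) Pn)))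
      ≈⟨ sym (negPow-+-double a b _) ⟩
    negPow R (a ℕ.+ (b ℕ.+ b)) (fromℕ R (K ℕ.* ∏pred (filter (_∣? q) Pn)))
      ≡⟨ ≡.cong₂ (λ e m → negPow R e (fromℕ R (K ℕ.* m)))
                 (≡.trans (≡.sym (ℕ.+-assoc a b b)) (≡.cong (ℕ._+ b) (≡.sym (ω-split q n)))) (≡.sym (φ-rad-gcd q n)) ⟩
    negPow R (ω n ℕ.+ ω (gcd q n)) (fromℕ R (K ℕ.* φ (rad (gcd q n)))) ∎
    where
    Pn = primeDivisors n
    Pn-prime = proj₂ (primeDivisors-distinct n)
    a = length (primesNotDividing q Pn)
    b = ω (gcd q n)

  ^-order : ∀ {β t} p → (∀ x → β ^ x ≈ 1# ⇔ t ∣ x) → ∀ x → (β ^ p) ^ x ≈ 1# ⇔ t ∣ p ℕ.* x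
  ^-order {β} p β-order x =
    ⇔.trans (mk⇔ (trans (sym (^-assocʳ β p x))) (trans (^-assocʳ β p x))) (β-order (p ℕ.* x))

  module IntegralDomain (dom : IsIntegralDomain R) where

    rootOfUnity⇒≈1⊎∑≈0 : ∀ x M → x ^ M ≈ 1# → x ≈ 1# ⊎ ∑[ k < M ] (x ^ toℕ k) ≈ 0#
    rootOfUnity⇒≈1⊎∑≈0 x M x^M≈1 with proj₂ dom (x - 1#) _ (trans (geometric-sum x M) (trans (+-congʳ x^M≈1) (-‿inverseʳ 1#)))
    ... | inj₁ x-1≈0 = inj₁ (x∙y⁻¹≈ε⇒x≈y x 1# x-1≈0)
    ... | inj₂ ∑≈0   = inj₂ ∑≈0

    sieveSum-[]-closed : ∀ K {t} β → (∀ x → β ^ x ≈ 1# ⇔ t ∣ x) → t ∣ K ℕ.* 1 →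
                         sieveSum [] (K ℕ.* 1) β ≈ ramanujanValue K [] t
    sieveSum-[]-closed K {t} β β-order t∣M = cases (t ∣? 1)
      where
      M = K ℕ.* 1
      cases : Dec (t ∣ 1) → sieveSum [] M β ≈ ramanujanValue K [] t
      cases (yes t∣1) = begin
        sieveSum [] M β               ≡⟨ sieveSum-[] M β ⟩
        ∑[ k < M ] (β ^ suc (toℕ k))  ≈⟨ sum-cong-≋ {M} (λ k → trans (^-congˡ (suc (toℕ k)) β≈1) (1^k≈1 (suc (toℕ k)))) ⟩
        ∑[ k < M ] 1#                 ≈⟨ ∑1≈fromℕ M ⟩
        fromℕ R M                     ≡⟨ ≡.sym (ramanujanValue-∣ K [] t∣1) ⟩
        ramanujanValue K [] t         ∎
        where
        β≈1 : β ≈ 1#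
        β≈1 = trans (sym (*-identityʳ β)) (from (β-order 1) t∣1)
      cases (no t∤1) = begin
        sieveSum [] M β             ≡⟨ sieveSum-[] M β ⟩
        ∑[ k < M ] (β * β ^ toℕ k)  ≈⟨ sym (*-distribˡ-sum {M} β (λ k → β ^ toℕ k)) ⟩
        β * ∑[ k < M ] (β ^ toℕ k)  ≈⟨ *-congˡ ∑≈0 ⟩
        β * 0#                      ≈⟨ zeroʳ β ⟩
        0#                          ≡⟨ ≡.sym (ramanujanValue-∤ K [] t∤1) ⟩
        ramanujanValue K [] t       ∎
        where
        β≉1 : ¬ β ≈ 1#
        β≉1 β≈1 = t∤1 (to (β-order 1) (trans (*-identityʳ β) β≈1))
        ∑≈0 : ∑[ k < M ] (β ^ toℕ k) ≈ 0#
        ∑≈0 = fromInj₂ (λ β≈1 → contradiction β≈1 β≉1) (rootOfUnity⇒≈1⊎∑≈0 β M (from (β-order M) t∣M))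

    sieveSum-closed : ∀ {L} → DistinctPrimes L → ∀ K {t} β → (∀ x → β ^ x ≈ 1# ⇔ t ∣ x) → t ∣ K ℕ.* product L →
                      sieveSum L (K ℕ.* product L) β ≈ ramanujanValue K L t
    sieveSum-closed {[]} _ = sieveSum-[]-closed
    sieveSum-closed {p ∷ L} ps@(p∉L ∷ L! , p-prime ∷ L-prime) K {t} β β-order t∣M = step (p ∣? t)
      where
      instance p≢0 = prime⇒nonZero p-prime
      P = product L
      L-ps : DistinctPrimes L
      L-ps = L! , L-prime
      reassoc : K ℕ.* (p ℕ.* P) ≡.≡ p ℕ.* (K ℕ.* P)
      reassoc = x*[y*z]≡y*[x*z] K p P
      t∣p*KP : t ∣ p ℕ.* (K ℕ.* P)
      t∣p*KP = ≡.subst (t ∣_) reassoc t∣M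
      split : sieveSum (p ∷ L) (K ℕ.* (p ℕ.* P)) β + sieveSum L (K ℕ.* P) (β ^ p) ≈ ramanujanValue (p ℕ.* K) L t
      split = begin
        sieveSum (p ∷ L) (K ℕ.* (p ℕ.* P)) β + sieveSum L (K ℕ.* P) (β ^ p)
          ≡⟨ ≡.cong (λ M → sieveSum (p ∷ L) M β + sieveSum L (K ℕ.* P) (β ^ p)) reassoc ⟩
        sieveSum (p ∷ L) (p ℕ.* (K ℕ.* P)) β + sieveSum L (K ℕ.* P) (β ^ p)
          ≈⟨ sym (sieveSum-split (K ℕ.* P) β ps) ⟩
        sieveSum L (p ℕ.* (K ℕ.* P)) β
          ≡⟨ ≡.cong (λ M → sieveSum L M β) (≡.sym (ℕ.*-assoc p K P)) ⟩
        sieveSum L ((p ℕ.* K) ℕ.* P) β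
          ≈⟨ sieveSum-closed L-ps (p ℕ.* K) β β-order (≡.subst (t ∣_) (≡.sym (ℕ.*-assoc p K P)) t∣p*KP) ⟩
        ramanujanValue (p ℕ.* K) L t ∎
      step : Dec (p ∣ t) → sieveSum (p ∷ L) (K ℕ.* (p ℕ.* P)) β ≈ ramanujanValue K (p ∷ L) t
      step (no p∤t) = +-cancelʳ (ramanujanValue K L t) _ _ (begin
        sieveSum (p ∷ L) (K ℕ.* (p ℕ.* P)) β + ramanujanValue K L t       ≈⟨ +-congˡ (sym IH) ⟩
        sieveSum (p ∷ L) (K ℕ.* (p ℕ.* P)) β + sieveSum L (K ℕ.* P) (β ^ p) ≈⟨ split ⟩
        ramanujanValue (p ℕ.* K) L t                                       ≈⟨ ramanujanValue-∤p K t ps p∤t ⟩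
        ramanujanValue K (p ∷ L) t + ramanujanValue K L t                  ∎)
        where
        t⊥p = Coprime.sym (prime∤⇒coprime p-prime p∤t)
        IH = sieveSum-closed L-ps K (β ^ p) (λ x → ⇔.trans (^-order p β-order x) (coprime-∣*⇔ x t⊥p))
                             (to (coprime-∣*⇔ (K ℕ.* P) t⊥p) t∣p*KP)
      -- Now t ∤ ∏L, so the sum over the integers up to p·K·∏L prime to ∏L vanishes.
      step (yes (divides t₀ t≡t₀p)) = begin
        sieveSum (p ∷ L) (K ℕ.* (p ℕ.* P)) β  ≈⟨ +-inverseˡ-unique _ _ (trans (+-congˡ (sym IH)) (trans split rv≈0)) ⟩
        - ramanujanValue K L t₀               ≈⟨ sym (ramanujanValue-∣p K t₀ ps) ⟩
        ramanujanValue K (p ∷ L) (t₀ ℕ.* p)   ≡⟨ ≡.cong (ramanujanValue K (p ∷ L)) (≡.sym t≡t₀p) ⟩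
        ramanujanValue K (p ∷ L) t            ∎
        where
        t∣px⇔t₀∣x : ∀ x → t ∣ p ℕ.* x ⇔ t₀ ∣ x
        t∣px⇔t₀∣x x = ≡.subst (λ u → u ∣ p ℕ.* x ⇔ t₀ ∣ x) (≡.sym t≡t₀p) (*∣*⇔ t₀ p x)
        IH = sieveSum-closed L-ps K (β ^ p) (λ x → ⇔.trans (^-order p β-order x) (t∣px⇔t₀∣x x))
                             (to (t∣px⇔t₀∣x (K ℕ.* P)) t∣p*KP)
        p∤P : ¬ p ∣ P
        p∤P p∣P = All.lookup p∉L (factorisationHasAllPrimeFactors p-prime p∣P L-prime) ≡.refl
        rv≈0 : ramanujanValue (p ℕ.* K) L t ≈ 0#
        rv≈0 = reflexive (ramanujanValue-∤ (p ℕ.* K) L (λ t∣P → p∤P (∣-trans (divides t₀ t≡t₀p) t∣P)))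

  module Conjugation (conj : Carrier → Carrier) (conj-isConjugation : IsConjugation R conj) where
    open IsConjugation conj-isConjugation

    conj-0# : conj 0# ≈ 0#
    conj-0# = x+x≈x⇒x≈0 _ (trans (sym (conj-+ 0# 0#)) (cong-conj (+-identityˡ 0#)))

    conj-‿ : ∀ x → conj (- x) ≈ - conj x
    conj-‿ x = +-inverseʳ-unique (conj x) (conj (- x))
      (trans (sym (conj-+ x (- x))) (trans (cong-conj (-‿inverseʳ x)) conj-0#))

    conj-fromℕ : ∀ k → conj (fromℕ R k) ≈ fromℕ R k
    conj-fromℕ zero    = conj-0#
    conj-fromℕ (suc k) = trans (conj-+ 1# _) (+-cong conj-1 (conj-fromℕ k))

    conj-negPow : ∀ s x → conj (negPow R s x) ≈ negPow R s (conj x)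
    conj-negPow zero    x = refl
    conj-negPow (suc s) x = trans (conj-‿ _) (-‿cong (conj-negPow s x))

    conj-^ : ∀ x k → conj (x ^ k) ≈ conj x ^ k
    conj-^ x zero    = conj-1
    conj-^ x (suc k) = trans (conj-* x _) (*-congˡ (conj-^ x k))

    conj-sumList : ∀ h xs → conj (sumList h xs) ≈ sumList (conj ∘ h) xs
    conj-sumList h []       = conj-0#
    conj-sumList h (x ∷ xs) = trans (conj-+ _ _) (+-congˡ (conj-sumList h xs))

    unit-^ : ∀ {x} → conj x * x ≈ 1# → ∀ a → conj (x ^ a) * x ^ a ≈ 1#
    unit-^ {x} x-unit a = begin
      conj (x ^ a) * x ^ a  ≈⟨ *-congʳ (conj-^ x a) ⟩
      conj x ^ a * x ^ a    ≈⟨ sym (^-distrib-* (conj x) x a) ⟩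
      (conj x * x) ^ a      ≈⟨ ^-congˡ a x-unit ⟩
      1# ^ a                ≈⟨ 1^k≈1 a ⟩
      1#                    ∎

    gramTerm-≤ : ∀ {x} → conj x * x ≈ 1# → ∀ i d → conj (x ^ i) * x ^ (i ℕ.+ d) ≈ x ^ d
    gramTerm-≤ {x} x-unit i d = begin
      conj (x ^ i) * x ^ (i ℕ.+ d)    ≈⟨ *-congˡ (^-homo-* x i d) ⟩
      conj (x ^ i) * (x ^ i * x ^ d)  ≈⟨ sym (*-assoc _ _ _) ⟩
      conj (x ^ i) * x ^ i * x ^ d    ≈⟨ *-congʳ (unit-^ x-unit i) ⟩
      1# * x ^ d                      ≈⟨ *-identityˡ _ ⟩
      x ^ d                           ∎

    gramTerm-≥ : ∀ {x} → conj x * x ≈ 1# → ∀ j d → conj (x ^ (j ℕ.+ d)) * x ^ j ≈ conj (x ^ d)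
    gramTerm-≥ {x} x-unit j d = begin
      conj (x ^ (j ℕ.+ d)) * x ^ j             ≈⟨ *-congʳ (trans (cong-conj (^-homo-* x j d)) (conj-* _ _)) ⟩
      conj (x ^ j) * conj (x ^ d) * x ^ j      ≈⟨ *-congʳ (*-comm _ _) ⟩
      conj (x ^ d) * conj (x ^ j) * x ^ j      ≈⟨ *-assoc _ _ _ ⟩
      conj (x ^ d) * (conj (x ^ j) * x ^ j)    ≈⟨ *-congˡ (unit-^ x-unit j) ⟩
      conj (x ^ d) * 1#                        ≈⟨ *-identityʳ _ ⟩
      conj (x ^ d)                             ∎

  -- Primitive roots of unity

  primitive⇒^n≈1 : ∀ {n β} → IsPrimitiveRoot R n β → β ^ n ≈ 1#
  primitive⇒^n≈1 {n} {β} β-primitive = trans (reflexive (≡.sym (pow≡^ β n))) (proj₁ β-primitive)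

  primitive⇒^≉1 : ∀ {n β} → IsPrimitiveRoot R n β → ∀ d → 1 ℕ.≤ d → d ℕ.< n → ¬ β ^ d ≈ 1#
  primitive⇒^≉1 {β = β} β-primitive d 1≤d d<n β^d≈1 = proj₂ β-primitive d 1≤d d<n (trans (reflexive (pow≡^ β d)) β^d≈1)

  module PrimitiveRoot (dom : IsIntegralDomain R) (char0 : CharZero R)
                       {n′ : ℕ} {ζ : Carrier} (ζ-primitive : IsPrimitiveRoot R (suc n′) ζ) where
    open IntegralDomain dom

    private
      n = suc n′

    ζ^[k*n]≈1 : ∀ k → ζ ^ (k ℕ.* n) ≈ 1#
    ζ^[k*n]≈1 k = begin
      ζ ^ (k ℕ.* n)   ≡⟨ ≡.cong (ζ ^_) (ℕ.*-comm k n) ⟩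
      ζ ^ (n ℕ.* k)   ≈⟨ sym (^-assocʳ ζ n k) ⟩
      (ζ ^ n) ^ k     ≈⟨ ^-congˡ k (primitive⇒^n≈1 ζ-primitive) ⟩
      1# ^ k          ≈⟨ 1^k≈1 k ⟩
      1#              ∎

    ζ^e≈1⇔n∣e : ∀ e → ζ ^ e ≈ 1# ⇔ n ∣ e
    ζ^e≈1⇔n∣e e = mk⇔ into onto
      where
      onto : n ∣ e → ζ ^ e ≈ 1#
      onto (divides k ≡.refl) = ζ^[k*n]≈1 k
      into : ζ ^ e ≈ 1# → n ∣ e
      into ζ^e≈1 with e % n ℕ.≟ 0
      ... | yes e%n≡0 = m%n≡0⇒n∣m e n e%n≡0
      ... | no e%n≢0  = contradiction ζ^[e%n]≈1 (primitive⇒^≉1 ζ-primitive (e % n) (ℕ.n≢0⇒n>0 e%n≢0) (m%n<n e n))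
        where
        ζ^[e%n]≈1 : ζ ^ (e % n) ≈ 1#
        ζ^[e%n]≈1 = begin
          ζ ^ (e % n)                        ≈⟨ sym (*-identityʳ _) ⟩
          ζ ^ (e % n) * 1#                   ≈⟨ *-congˡ (sym (ζ^[k*n]≈1 (e / n))) ⟩
          ζ ^ (e % n) * ζ ^ (e / n ℕ.* n)    ≈⟨ sym (^-homo-* ζ (e % n) (e / n ℕ.* n)) ⟩
          ζ ^ (e % n ℕ.+ e / n ℕ.* n)        ≡⟨ ≡.cong (ζ ^_) (≡.sym (m≡m%n+[m/n]*n e n)) ⟩
          ζ ^ e                              ≈⟨ ζ^e≈1 ⟩
          1#                                 ∎

    -- With ζ⁻¹ = ζ^(n-1): Σ_k Σ_j (β·ζ⁻¹^k)^j = n ≠ 0, since after swapping the sums only j = 0 survives,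
    -- while each inner sum over j vanishes unless β·ζ⁻¹^k = 1.
    rootOfUnity⇒power : ∀ β → β ^ n ≈ 1# → ∃ λ (k : Fin n) → β ≈ ζ ^ toℕ k
    rootOfUnity⇒power β β^n≈1 = conclude (∃⊎∀ (λ k → Sum.map₁ (y≈1⇒β≈ζ^k k) (rootOfUnity⇒≈1⊎∑≈0 (y k) n (y^n≈1 k))))
      where
      ζ⁻¹ = ζ ^ n′
      ζ⁻¹*ζ≈1 : ζ⁻¹ * ζ ≈ 1#
      ζ⁻¹*ζ≈1 = trans (*-comm ζ⁻¹ ζ) (primitive⇒^n≈1 ζ-primitive)
      y : Fin n → Carrier
      y k = β * ζ⁻¹ ^ toℕ k
      ζ⁻¹^n≈1 : ζ⁻¹ ^ n ≈ 1#
      ζ⁻¹^n≈1 = trans ([x^a]^b≈[x^b]^a ζ n′ n) (trans (^-congˡ n′ (primitive⇒^n≈1 ζ-primitive)) (1^k≈1 n′))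
      y^n≈1 : ∀ k → y k ^ n ≈ 1#
      y^n≈1 k = begin
        (β * ζ⁻¹ ^ toℕ k) ^ n      ≈⟨ ^-distrib-* β (ζ⁻¹ ^ toℕ k) n ⟩
        β ^ n * (ζ⁻¹ ^ toℕ k) ^ n  ≈⟨ *-cong β^n≈1 ([x^a]^b≈[x^b]^a ζ⁻¹ (toℕ k) n) ⟩
        1# * (ζ⁻¹ ^ n) ^ toℕ k     ≈⟨ trans (*-identityˡ _) (^-congˡ (toℕ k) ζ⁻¹^n≈1) ⟩
        1# ^ toℕ k                 ≈⟨ 1^k≈1 (toℕ k) ⟩
        1#                         ∎
      y≈1⇒β≈ζ^k : ∀ k → y k ≈ 1# → β ≈ ζ ^ toℕ k
      y≈1⇒β≈ζ^k k y≈1 = begin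
        β                               ≈⟨ sym (*-identityʳ β) ⟩
        β * 1#                          ≈⟨ *-congˡ (sym (trans (^-congˡ (toℕ k) ζ⁻¹*ζ≈1) (1^k≈1 (toℕ k)))) ⟩
        β * (ζ⁻¹ * ζ) ^ toℕ k           ≈⟨ *-congˡ (^-distrib-* ζ⁻¹ ζ (toℕ k)) ⟩
        β * (ζ⁻¹ ^ toℕ k * ζ ^ toℕ k)   ≈⟨ sym (*-assoc β _ _) ⟩
        y k * ζ ^ toℕ k                 ≈⟨ *-congʳ y≈1 ⟩
        1# * ζ ^ toℕ k                  ≈⟨ *-identityˡ _ ⟩
        ζ ^ toℕ k                       ∎
      ζ⁻¹^j≉1 : ∀ j → 1 ℕ.≤ j → j ℕ.< n → ¬ ζ⁻¹ ^ j ≈ 1#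
      ζ⁻¹^j≉1 j 1≤j j<n ζ⁻¹^j≈1 = primitive⇒^≉1 ζ-primitive j 1≤j j<n (begin
        ζ ^ j                 ≈⟨ sym (*-identityˡ _) ⟩
        1# * ζ ^ j            ≈⟨ *-congʳ (sym ζ⁻¹^j≈1) ⟩
        ζ⁻¹ ^ j * ζ ^ j       ≈⟨ sym (^-distrib-* ζ⁻¹ ζ j) ⟩
        (ζ⁻¹ * ζ) ^ j         ≈⟨ ^-congˡ j ζ⁻¹*ζ≈1 ⟩
        1# ^ j                ≈⟨ 1^k≈1 j ⟩
        1#                    ∎)
      ∑ζ⁻ʲᵏ≈0 : ∀ (j : Fin n′) → ∑[ k < n ] ((ζ⁻¹ ^ suc (toℕ j)) ^ toℕ k) ≈ 0#
      ∑ζ⁻ʲᵏ≈0 j = fromInj₂ (λ ≈1 → contradiction ≈1 (ζ⁻¹^j≉1 (suc (toℕ j)) (ℕ.s≤s ℕ.z≤n) (ℕ.s≤s (toℕ<n j))))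
                    (rootOfUnity⇒≈1⊎∑≈0 _ n (trans ([x^a]^b≈[x^b]^a ζ⁻¹ (suc (toℕ j)) n)
                                                    (trans (^-congˡ (suc (toℕ j)) ζ⁻¹^n≈1) (1^k≈1 (suc (toℕ j))))))
      ∑ₖy^j≈β^j*∑ₖζ⁻ʲᵏ : ∀ (j : Fin n) → ∑[ k < n ] (y k ^ toℕ j) ≈ β ^ toℕ j * ∑[ k < n ] ((ζ⁻¹ ^ toℕ j) ^ toℕ k)
      ∑ₖy^j≈β^j*∑ₖζ⁻ʲᵏ j = begin
        ∑[ k < n ] (y k ^ toℕ j)
          ≈⟨ sum-cong-≋ {n} (λ k → trans (^-distrib-* β (ζ⁻¹ ^ toℕ k) (toℕ j)) (*-congˡ ([x^a]^b≈[x^b]^a ζ⁻¹ (toℕ k) (toℕ j)))) ⟩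
        ∑[ k < n ] (β ^ toℕ j * (ζ⁻¹ ^ toℕ j) ^ toℕ k)    ≈⟨ sym (*-distribˡ-sum {n} (β ^ toℕ j) (λ k → (ζ⁻¹ ^ toℕ j) ^ toℕ k)) ⟩
        β ^ toℕ j * ∑[ k < n ] ((ζ⁻¹ ^ toℕ j) ^ toℕ k)    ∎
      ∑∑y≈n : ∑[ k < n ] ∑[ j < n ] (y k ^ toℕ j) ≈ fromℕ R n
      ∑∑y≈n = begin
        ∑[ k < n ] ∑[ j < n ] (y k ^ toℕ j)                              ≈⟨ ∑-comm {n} {n} (λ k j → y k ^ toℕ j) ⟩
        ∑[ j < n ] ∑[ k < n ] (y k ^ toℕ j)                              ≈⟨ sum-cong-≋ {n} ∑ₖy^j≈β^j*∑ₖζ⁻ʲᵏ ⟩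
        1# * ∑[ k < n ] (1# ^ toℕ k)
          + ∑[ j < n′ ] (β ^ suc (toℕ j) * ∑[ k < n ] ((ζ⁻¹ ^ suc (toℕ j)) ^ toℕ k))
          ≈⟨ +-cong (trans (*-identityˡ _) (trans (sum-cong-≋ {n} (λ k → 1^k≈1 (toℕ k))) (∑1≈fromℕ n)))
                    (∑-zero n′ (λ j → trans (*-congˡ (∑ζ⁻ʲᵏ≈0 j)) (zeroʳ _))) ⟩
        fromℕ R n + 0#                                                   ≈⟨ +-identityʳ _ ⟩
        fromℕ R n                                                        ∎
      conclude : (∃ λ k → β ≈ ζ ^ toℕ k) ⊎ (∀ k → ∑[ j < n ] (y k ^ toℕ j) ≈ 0#) → ∃ λ k → β ≈ ζ ^ toℕ k
      conclude (inj₁ found) = found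
      conclude (inj₂ ∑y≈0)  = contradiction (trans (sym ∑∑y≈n) (∑-zero n ∑y≈0)) (char0 n′)

    primitivePower⇒coprime : ∀ {β} a → IsPrimitiveRoot R n β → β ≈ ζ ^ a → gcd a n ≡.≡ 1
    primitivePower⇒coprime {β} a β-primitive β≈ζ^a with gcd a n ℕ.≟ 1
    ... | yes g≡1 = g≡1
    ... | no g≢1  = contradiction β^Q≈1 (primitive⇒^≉1 β-primitive Q (ℕ.>-nonZero⁻¹ Q) (m/n<m n g 1<g))
      where
      g = gcd a n
      instance
        g≢0 : NonZero g
        g≢0 = ℕ.≢-nonZero (gcd[m,n]≢0 a n (inj₂ λ ()))
      Q = n / g
      instance
        Q≢0 : NonZero Q
        Q≢0 = ℕ.≢-nonZero (n/gcd[m,n]≢0 a n)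
      1<g : 1 ℕ.< g
      1<g = ℕ.≤∧≢⇒< (ℕ.>-nonZero⁻¹ g) (≢-sym g≢1)
      a*Q≡[a/g]*n : a ℕ.* Q ≡.≡ a / g ℕ.* n
      a*Q≡[a/g]*n = ≡.trans (≡.cong (ℕ._* Q) (≡.sym (m/n*n≡m (gcd[m,n]∣m a n))))
                   (≡.trans (ℕ.*-assoc (a / g) g Q) (≡.cong (a / g ℕ.*_) (m*[n/m]≡n (gcd[m,n]∣n a n))))
      β^Q≈1 : β ^ Q ≈ 1#
      β^Q≈1 = begin
        β ^ Q              ≈⟨ ^-congˡ Q β≈ζ^a ⟩
        (ζ ^ a) ^ Q        ≈⟨ ^-assocʳ ζ a Q ⟩
        ζ ^ (a ℕ.* Q)      ≡⟨ ≡.cong (ζ ^_) a*Q≡[a/g]*n ⟩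
        ζ ^ (a / g ℕ.* n)  ≈⟨ ζ^[k*n]≈1 (a / g) ⟩
        1#                 ∎

    primitivePower∈coprimesUpTo : ∀ {β} a → IsPrimitiveRoot R n β → 1 ℕ.≤ a → a ℕ.≤ n → β ≈ ζ ^ a → a ∈ coprimesUpTo n
    primitivePower∈coprimesUpTo a β-primitive 1≤a a≤n β≈ζ^a =
      ∈-filter⁺ (λ a → gcd a n ℕ.≟ 1) (∈-oneTo⁺ 1≤a a≤n) (primitivePower⇒coprime a β-primitive β≈ζ^a)

    primitiveRoot⇒coprimePower : ∀ {β} → IsPrimitiveRoot R n β → ∃ λ a → a ∈ coprimesUpTo n × β ≈ ζ ^ a
    primitiveRoot⇒coprimePower {β} β-primitive with rootOfUnity⇒power β (primitive⇒^n≈1 β-primitive)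
    ... | Fin.zero , β≈1 =
      n , primitivePower∈coprimesUpTo n β-primitive (ℕ.s≤s ℕ.z≤n) ℕ.≤-refl β≈ζ^n , β≈ζ^n
      where β≈ζ^n = trans β≈1 (sym (primitive⇒^n≈1 ζ-primitive))
    ... | Fin.suc k , β≈ζ^k =
      suc (toℕ k) , primitivePower∈coprimesUpTo (suc (toℕ k)) β-primitive (ℕ.s≤s ℕ.z≤n) (ℕ.s≤s (toℕ≤n k)) β≈ζ^k , β≈ζ^k

    ∑-primitiveRoots : (α : Fin (φ n) → Carrier) → Injective ≡._≡_ _≈_ α → (∀ k → IsPrimitiveRoot R n (α k)) →
                       ∀ h → (∀ {x y} → x ≈ y → h x ≈ h y) →
                       ∑[ k < φ n ] h (α k) ≈ sumList (h ∘ (ζ ^_)) (coprimesUpTo n)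
    ∑-primitiveRoots α α-injective α-primitive h h-cong = begin
      ∑[ k < φ n ] h (α k)                    ≈⟨ sum-cong-≋ {φ n} (λ k → h-cong (α≈ζ^a k)) ⟩
      ∑[ k < φ n ] h (ζ ^ a k)                ≡⟨ ≡.sym (sumList-tabulate (h ∘ (ζ ^_)) a) ⟩
      sumList (h ∘ (ζ ^_)) (tabulate a)       ≈⟨ sumList-↭ (h ∘ (ζ ^_)) tabulate↭coprimes ⟩
      sumList (h ∘ (ζ ^_)) (coprimesUpTo n)   ∎
      where
      a : Fin (φ n) → ℕ
      a k = proj₁ (primitiveRoot⇒coprimePower (α-primitive k))
      α≈ζ^a : ∀ k → α k ≈ ζ ^ a k
      α≈ζ^a k = proj₂ (proj₂ (primitiveRoot⇒coprimePower (α-primitive k)))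
      a-injective : ∀ {k l} → a k ≡.≡ a l → k ≡.≡ l
      a-injective {k} {l} ak≡al = α-injective (trans (α≈ζ^a k) (trans (reflexive (≡.cong (ζ ^_) ak≡al)) (sym (α≈ζ^a l))))
      tabulate⊆coprimes : ∀ {x} → x ∈ tabulate a → x ∈ coprimesUpTo n
      tabulate⊆coprimes x∈ with ∈-tabulate⁻ x∈
      ... | k , ≡.refl = proj₁ (proj₂ (primitiveRoot⇒coprimePower (α-primitive k)))
      tabulate↭coprimes : tabulate a ↭ coprimesUpTo n
      tabulate↭coprimes = ⊆∧length≤⇒↭ (Unique.tabulate⁺ a-injective) tabulate⊆coprimes
                                       (ℕ.≤-reflexive (≡.sym (length-tabulate a)))

    ramanujanSum : ℕ → Carrier
    ramanujanSum d = sieveSum (primeDivisors n) n (ζ ^ d)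

    ramanujanSum≈ramanujanValue : ∀ d {t} → (∀ x → n ∣ d ℕ.* x ⇔ t ∣ x) →
                                  ramanujanSum d ≈ ramanujanValue (nOverRad n) (primeDivisors n) t
    ramanujanSum≈ramanujanValue d {t} t-spec = begin
      sieveSum (primeDivisors n) n (ζ ^ d)
        ≡⟨ ≡.cong (λ M → sieveSum (primeDivisors n) M (ζ ^ d)) (≡.sym (nOverRad*rad≡n n)) ⟩
      sieveSum (primeDivisors n) (nOverRad n ℕ.* rad n) (ζ ^ d)
        ≈⟨ sieveSum-closed (primeDivisors-distinct n) (nOverRad n) (ζ ^ d) ζ^d-order t∣N*rad ⟩
      ramanujanValue (nOverRad n) (primeDivisors n) t ∎
      where
      ζ^d-order : ∀ x → (ζ ^ d) ^ x ≈ 1# ⇔ t ∣ x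
      ζ^d-order x = ⇔.trans (^-order d ζ^e≈1⇔n∣e x) (t-spec x)
      t∣N*rad : t ∣ nOverRad n ℕ.* rad n
      t∣N*rad = ≡.subst (t ∣_) (≡.sym (nOverRad*rad≡n n)) (to (t-spec n) (n∣m*n d))

  -- The Gram matrix of the Vandermonde matrix

  module VandermondeGram (dom : IsIntegralDomain R) (char0 : CharZero R)
                         (conj : Carrier → Carrier) (conj-isConjugation : IsConjugation R conj)
                         {n′ : ℕ} (α : Fin (φ (suc n′)) → Carrier) (α-injective : Injective ≡._≡_ _≈_ α)
                         (α-primitive : ∀ k → IsPrimitiveRoot R (suc n′) (α k))
                         (α-unitary : ∀ k → conj (α k) * α k ≈ 1#) where
    open Conjugation conj conj-isConjugation
    open IsConjugation conj-isConjugation using (cong-conj)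

    private
      n = suc n′

    gramEntry≈∑ : ∀ i j → gramEntry R conj (φ n) α i j ≈ ∑[ k < φ n ] (conj (α k ^ toℕ i) * α k ^ toℕ j)
    gramEntry≈∑ i j = trans (reflexive (sumFin≡sum (φ n) _)) (sum-cong-≋ {φ n} λ k →
      reflexive (≡.cong₂ (λ u v → conj u * v) (pow≡^ (α k) (toℕ i)) (pow≡^ (α k) (toℕ j))))

    gramEntry-diagonal : ∀ i → gramEntry R conj (φ n) α i i ≈ fromℕ R (φ n)
    gramEntry-diagonal i = trans (gramEntry≈∑ i i)
      (trans (sum-cong-≋ {φ n} (λ k → unit-^ (α-unitary k) (toℕ i))) (∑1≈fromℕ (φ n)))

    gramEntry≈ramanujanSum : ∀ i j → let open PrimitiveRoot dom char0 (α-primitive i) in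
                             gramEntry R conj (φ n) α i j ≈ ramanujanSum ∣ toℕ i - toℕ j ∣
                             ⊎ gramEntry R conj (φ n) α i j ≈ conj (ramanujanSum ∣ toℕ i - toℕ j ∣)
    gramEntry≈ramanujanSum i j = cases (toℕ i ℕ.≤? toℕ j)
      where
      open PrimitiveRoot dom char0 (α-primitive i)
      ζ = α i
      d = ∣ toℕ i - toℕ j ∣
      T : Carrier → Carrier
      T β = conj (β ^ toℕ i) * β ^ toℕ j
      T-cong : ∀ {x y} → x ≈ y → T x ≈ T y
      T-cong x≈y = *-cong (cong-conj (^-congˡ (toℕ i) x≈y)) (^-congˡ (toℕ j) x≈y)
      gram≈∑T : gramEntry R conj (φ n) α i j ≈ sumList (T ∘ (ζ ^_)) (sieve (primeDivisors n) n)
      gram≈∑T = begin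
        gramEntry R conj (φ n) α i j                        ≈⟨ gramEntry≈∑ i j ⟩
        ∑[ k < φ n ] T (α k)                                ≈⟨ ∑-primitiveRoots α α-injective α-primitive T T-cong ⟩
        sumList (T ∘ (ζ ^_)) (coprimesUpTo n)               ≡⟨ ≡.cong (sumList (T ∘ (ζ ^_))) coprimes≡sieve ⟩
        sumList (T ∘ (ζ ^_)) (sieve (primeDivisors n) n)    ∎
        where
        coprimes≡sieve : coprimesUpTo n ≡.≡ sieve (primeDivisors n) n
        coprimes≡sieve = coprimesUpTo≡sieve n (proj₂ (primeDivisors-distinct n))
                           (λ q-prime → mk⇔ (∈-primeDivisors⁺ q-prime) (λ q∈ → proj₂ (∈-primeDivisors⁻ {n} q∈)))
      ζ^a-unit : ∀ a → conj (ζ ^ a) * ζ ^ a ≈ 1#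
      ζ^a-unit = unit-^ (α-unitary i)
      cases : Dec (toℕ i ℕ.≤ toℕ j) → gramEntry R conj (φ n) α i j ≈ ramanujanSum d
                                      ⊎ gramEntry R conj (φ n) α i j ≈ conj (ramanujanSum d)
      cases (yes i≤j) = inj₁ (trans gram≈∑T (sumList-cong T[ζ^a]≈[ζ^d]^a (sieve (primeDivisors n) n)))
        where
        j≡i+d : toℕ j ≡.≡ toℕ i ℕ.+ d
        j≡i+d = ≡.sym (≡.trans (≡.cong (toℕ i ℕ.+_) (ℕ.m≤n⇒∣m-n∣≡n∸m i≤j)) (ℕ.m+[n∸m]≡n i≤j))
        T[ζ^a]≈[ζ^d]^a : ∀ a → T (ζ ^ a) ≈ (ζ ^ d) ^ a
        T[ζ^a]≈[ζ^d]^a a = begin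
          conj ((ζ ^ a) ^ toℕ i) * (ζ ^ a) ^ toℕ j           ≡⟨ ≡.cong (λ e → conj ((ζ ^ a) ^ toℕ i) * (ζ ^ a) ^ e) j≡i+d ⟩
          conj ((ζ ^ a) ^ toℕ i) * (ζ ^ a) ^ (toℕ i ℕ.+ d)   ≈⟨ gramTerm-≤ (ζ^a-unit a) (toℕ i) d ⟩
          (ζ ^ a) ^ d                                         ≈⟨ [x^a]^b≈[x^b]^a ζ a d ⟩
          (ζ ^ d) ^ a                                         ∎
      cases (no i≰j) = inj₂ (trans gram≈∑T (trans (sumList-cong T[ζ^a]≈conj[[ζ^d]^a] (sieve (primeDivisors n) n)) (sym (conj-sumList ((ζ ^ d) ^_) (sieve (primeDivisors n) n)))))
        where
        j≤i : toℕ j ℕ.≤ toℕ i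
        j≤i = ℕ.<⇒≤ (ℕ.≰⇒> i≰j)
        i≡j+d : toℕ i ≡.≡ toℕ j ℕ.+ d
        i≡j+d = ≡.sym (≡.trans (≡.cong (toℕ j ℕ.+_) (≡.trans (ℕ.∣-∣-comm (toℕ i) (toℕ j)) (ℕ.m≤n⇒∣m-n∣≡n∸m j≤i)))
                               (ℕ.m+[n∸m]≡n j≤i))
        T[ζ^a]≈conj[[ζ^d]^a] : ∀ a → T (ζ ^ a) ≈ conj ((ζ ^ d) ^ a)
        T[ζ^a]≈conj[[ζ^d]^a] a = begin
          conj ((ζ ^ a) ^ toℕ i) * (ζ ^ a) ^ toℕ j           ≡⟨ ≡.cong (λ e → conj ((ζ ^ a) ^ e) * (ζ ^ a) ^ toℕ j) i≡j+d ⟩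
          conj ((ζ ^ a) ^ (toℕ j ℕ.+ d)) * (ζ ^ a) ^ toℕ j   ≈⟨ gramTerm-≥ (ζ^a-unit a) (toℕ j) d ⟩
          conj ((ζ ^ a) ^ d)                                  ≈⟨ cong-conj ([x^a]^b≈[x^b]^a ζ a d) ⟩
          conj ((ζ ^ d) ^ a)                                  ∎

    gramEntry≈selfConjugate : ∀ i j {v} → conj v ≈ v →
                              (let open PrimitiveRoot dom char0 (α-primitive i) in ramanujanSum ∣ toℕ i - toℕ j ∣ ≈ v) →
                              gramEntry R conj (φ n) α i j ≈ v
    gramEntry≈selfConjugate i j conj[v]≈v c≈v with gramEntry≈ramanujanSum i j
    ... | inj₁ gram≈c = trans gram≈c c≈v
    ... | inj₂ gram≈c̄ = trans gram≈c̄ (trans (cong-conj c≈v) conj[v]≈v)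

theorem2 : ∀ {c ℓ} (R : CommutativeRing c ℓ) →
    let open CommutativeRing R in
    IsIntegralDomain R → CharZero R →
    (conj : Carrier → Carrier) → IsConjugation R conj →
    (n : ℕ) → 1 ≤ n →
    (α : Fin (φ n) → Carrier) →
    Injective _≡_ _≈_ α →
    (∀ k → IsPrimitiveRoot R n (α k)) →
    (∀ k → conj (α k) * α k ≈ 1#) →
    (i j : Fin (φ n)) →
      (i ≡ j → gramEntry R conj (φ n) α i j ≈ fromℕ R (φ n))
    × (¬ (nOverRad n ∣ ∣ toℕ i - toℕ j ∣) → gramEntry R conj (φ n) α i j ≈ 0#)
    × (¬ (i ≡ j) → (q : ℕ) → ∣ toℕ i - toℕ j ∣ ≡ q N.* nOverRad n →
         gramEntry R conj (φ n) α i j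
           ≈ negPow R (ω n N.+ ω (gcd q n))
               (fromℕ R (nOverRad n N.* φ (rad (gcd q n)))))
theorem2 R dom char0 conj conj-isConjugation (N.suc n′) _ α α-injective α-primitive α-unitary i j =
  (λ { refl → gramEntry-diagonal i }) , vanishing , closedForm
  where
  open CommutativeRing R
  open import Relation.Binary.PropositionalEquality using (refl; cong)
  open import Relation.Binary.Reasoning.Setoid setoid
  open import Data.Nat.ListAction using (product)
  open NumberTheory
  open RootsOfUnity R
  open Conjugation conj conj-isConjugation
  open VandermondeGram dom char0 conj conj-isConjugation α α-injective α-primitive α-unitary
  open PrimitiveRoot dom char0 (α-primitive i)
  n = N.suc n′
  d = ∣ toℕ i - toℕ j ∣
  gram = gramEntry R conj (φ n) α i j

  vanishing : ¬ nOverRad n ∣ d → gram ≈ 0#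
  vanishing N∤d = gramEntry≈selfConjugate i j conj-0# (begin
    ramanujanSum d                                        ≈⟨ ramanujanSum≈ramanujanValue d t-spec ⟩
    ramanujanValue (nOverRad n) (primeDivisors n) t       ≡⟨ ramanujanValue-∤ (nOverRad n) (primeDivisors n) t∤rad ⟩
    0#                                                    ∎)
    where
    t = proj₁ (additiveOrder n d)
    t-spec = proj₂ (additiveOrder n d)
    t∤rad = nOverRad∤⇒∤rad n d t-spec N∤d

  closedForm : ¬ i ≡ j → ∀ q → d ≡ q N.* nOverRad n →
               gram ≈ negPow R (ω n N.+ ω (gcd q n)) (fromℕ R (nOverRad n N.* φ (rad (gcd q n))))
  closedForm _ q d≡qN = gramEntry≈selfConjugate i j (trans (conj-negPow s (fromℕ R m)) (negPow-cong s (conj-fromℕ m))) (begin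
    ramanujanSum d
      ≡⟨ cong ramanujanSum d≡qN ⟩
    ramanujanSum (q N.* nOverRad n)
      ≈⟨ ramanujanSum≈ramanujanValue (q N.* nOverRad n) (λ x → n∣q*nOverRad*x⇔ n q x) ⟩
    ramanujanValue (nOverRad n) (primeDivisors n) (product (primesNotDividing q (primeDivisors n)))
      ≈⟨ ramanujanValue-primesNotDividing (nOverRad n) q n ⟩
    negPow R s (fromℕ R m) ∎)
    where
    s = ω n N.+ ω (gcd q n)
    m = nOverRad n N.* φ (rad (gcd q n))
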